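{- For $n\ge1$ let $S_n(132)$ be the set of $132$-avoiding permutations of $\{1,\dots,n\}$, and for $\sigma=\sigma_1\cdots\sigma_n$ let $\mathrm{box}(\sigma)$ be the number of indices $i$ such that $|\sigma_i-\sigma_{i+1}|=1$ or $|\sigma_{i-1}-\sigma_i|=1$ (ignoring nonexistent entries). Let $A_0(x)=1$, $A_n(x)=\sum_{\sigma\in S_n(132)}x^{\mathrm{box}(\sigma)}$, $B_n(x)=\sum_{\sigma\in S_n(132),\sigma_1=n}x^{\mathrm{box}(\sigma)}$ and $E_n(x)=\sum_{\sigma\in S_n(132),\sigma_n=n}x^{\mathrm{box}(\sigma)}$ for $n\ge1$, and let $A(t,x)=\sum_{n\ge0}A_n(x)t^n$, $B(t,x)=\sum_{n\ge1}B_n(x)t^n$, $E(t,x)=\sum_{n\ge1}E_n(x)t^n$. Then $$A(t,x)=\frac{1+t+t^2-tx-t^2x-t^3x+t^3x^2-\sqrt{F(t,x)}}{2\big(t(1-xt)+x^2t^2\big)},$$ where $F(t,x)=(1+t+t^2-tx-t^2x-t^3x+t^3x^2)^2-4\big((1+t)(1-xt)+x^2t^2\big)\big(t(1-xt)+x^2t^2\big)$, and $$B(t,x)=E(t,x)=\frac{t(1-xt)+x^2t^2}{(1+t)(1-xt)+x^2t^2}\,A(t,x).$$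
   Context: A permutation $\sigma\in S_n$ avoids $132$ if there are no indices $i<j<k$ with $\sigma_i<\sigma_k<\sigma_j$. The square root is the branch making $A(t,x)$ a formal power series in $t$ with constant term $1$. -}

module Defs where

open import Data.Nat as ℕ using (ℕ; zero; suc; _∸_; _≡ᵇ_; _<ᵇ_)
open import Data.Integer as ℤ using (ℤ; +_)
open import Data.Bool using (Bool; true; false; _∧_; _∨_; if_then_else_; not)
open import Data.List using (List; []; _∷_; map; concatMap; filter; length; upTo; last)
open import Data.Bool.ListAction using (any)
open import Data.Maybe using (Maybe; just; nothing)
open import Relation.Binary.PropositionalEquality using (_≡_)
open import Relation.Nullary.Decidable using (Dec)
open import Data.Bool.Properties using () renaming (_≟_ to _≟ᵇ_)

words : ℕ → ℕ → List (List ℕ)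
words n zero    = [] ∷ []
words n (suc m) = concatMap (λ a → map (a ∷_) (words n m)) (map suc (upTo n))

distinct : List ℕ → Bool
distinct []      = true
distinct (a ∷ r) = not (any (λ b → a ≡ᵇ b) r) ∧ distinct r

S : ℕ → List (List ℕ)
S n = filter (λ σ → distinct σ ≟ᵇ true) (words n n)

pat132From : ℕ → List ℕ → Bool
pat132From a []      = false
pat132From a (b ∷ r) = any (λ c → (a <ᵇ c) ∧ (c <ᵇ b)) r ∨ pat132From a r

contains132 : List ℕ → Bool
contains132 []      = false
contains132 (a ∷ r) = pat132From a r ∨ contains132 r

avoids132 : List ℕ → Bool
avoids132 σ = not (contains132 σ)

adj : ℕ → ℕ → Bool
adj a b = (a ≡ᵇ suc b) ∨ (b ≡ᵇ suc a)

adjM : Maybe ℕ → ℕ → Bool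
adjM nothing  b = false
adjM (just a) b = adj a b

headM : List ℕ → Maybe ℕ
headM []      = nothing
headM (a ∷ _) = just a

-- boxAux p σ : p is the entry preceding σ (if any)
boxAux : Maybe ℕ → List ℕ → ℕ
boxAux p []      = zero
boxAux p (a ∷ r) = (if adjM p a ∨ adjM (headM r) a then 1 else 0) ℕ.+ boxAux (just a) r

box : List ℕ → ℕ
box σ = boxAux nothing σ

-- Bivariate formal power series in t and x over ℤ:
-- f n k = coefficient of tⁿ xᵏ.

Series : Set
Series = ℕ → ℕ → ℤ

_≈_ : Series → Series → Set
f ≈ g = ∀ n k → f n k ≡ g n k

infix 4 _≈_
infixl 6 _⊕_ _⊖_
infixl 7 _⊛_

_⊕_ : Series → Series → Series
(f ⊕ g) n k = f n k ℤ.+ g n k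

_⊖_ : Series → Series → Series
(f ⊖ g) n k = f n k ℤ.- g n k

sumTo : ℕ → (ℕ → ℤ) → ℤ
sumTo zero    f = f zero
sumTo (suc n) f = sumTo n f ℤ.+ f (suc n)

_⊛_ : Series → Series → Series
(f ⊛ g) n k = sumTo n (λ i → sumTo k (λ j → f i j ℤ.* g (n ∸ i) (k ∸ j)))

const : ℤ → Series
const c zero zero = c
const c _    _    = + 0

tS : Series
tS 1 0 = + 1
tS _ _ = + 0

xS : Series
xS 0 1 = + 1
xS _ _ = + 0

1S : Series
1S = const (+ 1)

countBox : (List ℕ → Bool) → List (List ℕ) → ℕ → ℕ
countBox p l k = length (filter (λ σ → (p σ ∧ (box σ ≡ᵇ k)) ≟ᵇ true) l)

-- A(t,x) = Σ_{n≥0} A_n(x) tⁿ with A₀ = 1  (S 0 = [ [] ], box [] = 0, so this gives A₀ = 1)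
Agf : Series
Agf n k = + countBox avoids132 (S n) k

-- B(t,x): σ ∈ S_n(132) with σ₁ = n  (n ≥ 1; for n = 0 the empty word has no first entry)
Bgf : Series
Bgf n k = + countBox (λ σ → avoids132 σ ∧ (headM σ ≡ᴹ n)) (S n) k
  where
  _≡ᴹ_ : Maybe ℕ → ℕ → Bool
  nothing ≡ᴹ n = false
  just a  ≡ᴹ n = a ≡ᵇ n

Egf : Series
Egf n k = + countBox (λ σ → avoids132 σ ∧ (last σ ≡ᴹ n)) (S n) k
  where
  _≡ᴹ_ : Maybe ℕ → ℕ → Bool
  nothing ≡ᴹ n = false
  just a  ≡ᴹ n = a ≡ᵇ n

Pp : Series
Pp = 1S ⊕ tS ⊕ tS ⊛ tS ⊖ tS ⊛ xS ⊖ tS ⊛ tS ⊛ xS ⊖ tS ⊛ tS ⊛ tS ⊛ xS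
     ⊕ tS ⊛ tS ⊛ tS ⊛ xS ⊛ xS

Qp : Series
Qp = tS ⊛ (1S ⊖ xS ⊛ tS) ⊕ xS ⊛ xS ⊛ tS ⊛ tS

Rp : Series
Rp = (1S ⊕ tS) ⊛ (1S ⊖ xS ⊛ tS) ⊕ xS ⊛ xS ⊛ tS ⊛ tS

Fp : Series
Fp = Pp ⊛ Pp ⊖ const (+ 4) ⊛ Rp ⊛ Qp

module Submission where

-- Every σ ∈ S_{n+1}(132) factors uniquely as σ = α′ (n+1) β with β ∈ S_{n-i}(132) and α′ a copy of some
-- α ∈ S_i(132) shifted above β; for i > 0, box σ = box α + g α + box β, where the gain g α ∈ {0, 1, 2} is
-- the increase of box caused by appending a new maximum to α. Sorting permutations by the gain of a
-- new maximum put in front (B₁ and B₂ for gains 1 and 2, so B = B₁ + B₂) and letting A⁺ weigh σ by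
-- x^(box σ + gain), the factorisation gives
--   B = t A⁺,   B₂ = t (A − B),   B₁ = t x (B₁ + x B₂),   A + t A = 1 + t A⁺ + t A⁺ A.
-- Front and back gains obey the same recurrences, hence are equidistributed: this gives E = B and lets
-- A⁺ serve at both ends. Eliminating B₁, B₂ and A⁺ leaves R B = Q A and Q A² − P A + R = 0, so P − 2 Q A
-- is a square root of F = P² − 4 R Q with constant term 1.

open import Algebra.Bundles using (CommutativeMonoid; CommutativeRing)
import Algebra.Properties.CommutativeSemigroup as CommSemigroupProperties
open import Algebra.Solver.Ring.AlmostCommutativeRing using (_-Raw-AlmostCommutative⟶_; fromCommutativeRing)
import Algebra.Solver.Ring as RingSolver
open import Data.Bool using (Bool; true; false; _∧_; _∨_; not; if_then_else_)
import Data.Bool.Properties as Bool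
open import Data.Bool.ListAction using (any)
open import Data.Empty using (⊥-elim)
open import Data.Integer as ℤ using (ℤ; +_)
import Data.Integer.Properties as ℤ
open import Data.List using (List; []; _∷_; [_]; _++_; map; concatMap; filter; length; upTo; last; cartesianProductWith)
import Data.List.Properties as List
open import Data.List.Membership.Propositional using (_∈_; _∉_)
import Data.List.Membership.Propositional.Properties as ∈
open import Data.List.Membership.Propositional.Properties.WithK using (unique∧set⇒bag)
open import Data.List.Relation.Binary.BagAndSetEquality using (∼bag⇒↭)
open import Data.List.Relation.Binary.Permutation.Propositional using (_↭_)
import Data.List.Relation.Binary.Permutation.Propositional.Properties as Perm
open import Data.List.Relation.Binary.Subset.Propositional using (_⊆_)
open import Data.List.Relation.Unary.All as All using (All; []; _∷_)
import Data.List.Relation.Unary.All.Properties as All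
import Data.List.Relation.Unary.AllPairs as AllPairs
open import Data.List.Relation.Unary.Any using (here; there)
open import Data.List.Relation.Unary.Unique.Propositional using (Unique; []; _∷_)
import Data.List.Relation.Unary.Unique.Propositional.Properties as Unique
open import Data.Maybe as Maybe using (Maybe; just; nothing)
open import Data.Nat as ℕ using (ℕ; zero; suc; _∸_; _≤_; _<_; z≤n; s≤s)
import Data.Nat.Properties as ℕ
open import Data.List.Membership.DecPropositional ℕ._≟_ using (_∈?_)
open import Data.Nat.Tactic.RingSolver using (solve-∀)
open import Data.Product using (Σ; ∃; ∃₂; _×_; _,_; proj₁; proj₂)
open import Data.Sum using (_⊎_; inj₁; inj₂)
open import Function using (_∘_; Equivalence; mk⇔)
open import Relation.Binary using (tri<; tri≈; tri>)
open import Relation.Binary.PropositionalEquality as ≡ using (_≡_; _≢_)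
import Relation.Binary.Reasoning.Setoid as SetoidReasoning
open import Relation.Nullary using (¬_; yes; no)

open import Defs hiding (_≈_)

-- Finite sums and formal power series

module RangeSum {c ℓ} (M : CommutativeMonoid c ℓ) where
  open CommutativeMonoid M
  open SetoidReasoning setoid
  open CommSemigroupProperties commutativeSemigroup using (interchange)

  sum : ℕ → (ℕ → Carrier) → Carrier
  sum zero    f = f zero
  sum (suc n) f = sum n f ∙ f (suc n)

  sum-cong : ∀ n {f g} → (∀ i → i ≤ n → f i ≈ g i) → sum n f ≈ sum n g
  sum-cong zero    f≈g = f≈g 0 z≤n
  sum-cong (suc n) f≈g =
    ∙-cong (sum-cong n (λ i i≤n → f≈g i (ℕ.m≤n⇒m≤1+n i≤n))) (f≈g (suc n) ℕ.≤-refl)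

  sum-zero : ∀ n f → (∀ i → i ≤ n → f i ≈ ε) → sum n f ≈ ε
  sum-zero n f f≈ε = trans (sum-cong n f≈ε) (ε-sum n)
    where
    ε-sum : ∀ n → sum n (λ _ → ε) ≈ ε
    ε-sum zero    = refl
    ε-sum (suc n) = trans (identityʳ _) (ε-sum n)

  sum-∙ : ∀ n f g → sum n (λ i → f i ∙ g i) ≈ sum n f ∙ sum n g
  sum-∙ zero    f g = refl
  sum-∙ (suc n) f g = trans (∙-cong (sum-∙ n f g) refl) (interchange _ _ _ _)

  sum-suc : ∀ n f → sum (suc n) f ≈ f 0 ∙ sum n (f ∘ suc)
  sum-suc zero    f = refl
  sum-suc (suc n) f = trans (∙-cong (sum-suc n f) refl) (assoc _ _ _)

  sum-single : ∀ n a f → a ≤ n → (∀ i → i ≤ n → i ≢ a → f i ≈ ε) → sum n f ≈ f a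
  sum-single zero    zero    f _   _      = refl
  sum-single (suc n) a       f a≤1+n others with a ℕ.≟ suc n
  ... | yes ≡.refl = begin
    sum n f ∙ f (suc n) ≈⟨ ∙-cong (sum-zero n f below) refl ⟩
    ε ∙ f (suc n)       ≈⟨ identityˡ _ ⟩
    f (suc n)           ∎
    where
    below : ∀ i → i ≤ n → f i ≈ ε
    below i i≤n = others i (ℕ.m≤n⇒m≤1+n i≤n) (ℕ.<⇒≢ (s≤s i≤n))
  ... | no a≢1+n = begin
    sum n f ∙ f (suc n) ≈⟨ ∙-cong (sum-single n a f a≤n below) (others (suc n) ℕ.≤-refl (a≢1+n ∘ ≡.sym)) ⟩
    f a ∙ ε             ≈⟨ identityʳ _ ⟩
    f a                 ∎
    where
    below : ∀ i → i ≤ n → i ≢ a → f i ≈ ε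
    below i i≤n = others i (ℕ.m≤n⇒m≤1+n i≤n)
    a≤n : a ≤ n
    a≤n = ℕ.≤-pred (ℕ.≤∧≢⇒< a≤1+n a≢1+n)

  sum-swap-head : ∀ n f g → (∀ i → i < n → f (suc i) ≈ g (suc i)) → sum n f ∙ g 0 ≈ f 0 ∙ sum n g
  sum-swap-head zero    f g _   = refl
  sum-swap-head (suc n) f g f≈g = begin
    sum (suc n) f ∙ g 0                ≈⟨ ∙-cong (sum-suc n f) refl ⟩
    (f 0 ∙ sum n (f ∘ suc)) ∙ g 0      ≈⟨ assoc _ _ _ ⟩
    f 0 ∙ (sum n (f ∘ suc) ∙ g 0)      ≈⟨ ∙-cong refl (comm _ _) ⟩
    f 0 ∙ (g 0 ∙ sum n (f ∘ suc))      ≈⟨ ∙-cong refl (∙-cong refl (sum-cong n (λ i i≤n → f≈g i (s≤s i≤n)))) ⟩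
    f 0 ∙ (g 0 ∙ sum n (g ∘ suc))      ≈⟨ ∙-cong refl (sum-suc n g) ⟨
    f 0 ∙ sum (suc n) g                ∎

  sum-reverse : ∀ n f → sum n f ≈ sum n (λ i → f (n ∸ i))
  sum-reverse zero    f = refl
  sum-reverse (suc n) f = begin
    sum n f ∙ f (suc n)                     ≈⟨ ∙-cong (sum-reverse n f) refl ⟩
    sum n (λ i → f (n ∸ i)) ∙ f (suc n)     ≈⟨ comm _ _ ⟩
    f (suc n) ∙ sum n (λ i → f (n ∸ i))     ≈⟨ sum-suc n (λ i → f (suc n ∸ i)) ⟨
    sum (suc n) (λ i → f (suc n ∸ i))       ∎

  sum-triangle : ∀ n (F : ℕ → ℕ → Carrier) →
    sum n (λ i → sum i (F i)) ≈ sum n (λ j → sum (n ∸ j) (λ m → F (j ℕ.+ m) j))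
  sum-triangle zero    F = refl
  sum-triangle (suc n) F = begin
    sum n (λ i → sum i (F i)) ∙ (sum n (F (suc n)) ∙ F (suc n) (suc n))
      ≈⟨ ∙-cong (sum-triangle n F) refl ⟩
    sum n (λ j → sum (n ∸ j) (column j)) ∙ (sum n (F (suc n)) ∙ F (suc n) (suc n))
      ≈⟨ assoc _ _ _ ⟨
    (sum n (λ j → sum (n ∸ j) (column j)) ∙ sum n (F (suc n))) ∙ F (suc n) (suc n)
      ≈⟨ ∙-cong (sum-∙ n _ _) refl ⟨
    sum n (λ j → sum (n ∸ j) (column j) ∙ F (suc n) j) ∙ F (suc n) (suc n)
      ≈⟨ ∙-cong (sum-cong n extend) (lastColumn n) ⟩
    sum n (λ j → sum (suc n ∸ j) (column j)) ∙ sum (suc n ∸ suc n) (column (suc n)) ∎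
    where
    column : ℕ → ℕ → Carrier
    column j m = F (j ℕ.+ m) j
    lastColumn : ∀ n → F (suc n) (suc n) ≈ sum (n ∸ n) (column (suc n))
    lastColumn n rewrite ℕ.n∸n≡0 n | ℕ.+-identityʳ n = refl
    extend : ∀ j → j ≤ n → sum (n ∸ j) (column j) ∙ F (suc n) j ≈ sum (suc n ∸ j) (column j)
    extend j j≤n rewrite ℕ.+-∸-assoc 1 j≤n =
      ∙-cong refl (reflexive (≡.cong (λ i → F i j) (≡.sym (≡.trans (ℕ.+-suc j (n ∸ j))
                                                           (≡.cong suc (ℕ.m+[n∸m]≡n j≤n))))))

module PowerSeries {c ℓ} (R : CommutativeRing c ℓ) where
  open CommutativeRing R
  open SetoidReasoning setoid
  open RangeSum +-commutativeMonoid public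

  *-distribˡ-sum : ∀ n a f → a * sum n f ≈ sum n (λ i → a * f i)
  *-distribˡ-sum zero    a f = refl
  *-distribˡ-sum (suc n) a f = trans (distribˡ _ _ _) (+-cong (*-distribˡ-sum n a f) refl)

  *-distribʳ-sum : ∀ n a f → sum n f * a ≈ sum n (λ i → f i * a)
  *-distribʳ-sum zero    a f = refl
  *-distribʳ-sum (suc n) a f = trans (distribʳ _ _ _) (+-cong (*-distribʳ-sum n a f) refl)

  infixl 7 _∗_

  _∗_ : (ℕ → Carrier) → (ℕ → Carrier) → ℕ → Carrier
  (f ∗ g) n = sum n (λ i → f i * g (n ∸ i))

  one : ℕ → Carrier
  one zero    = 1#
  one (suc _) = 0#

  ∗-cong : ∀ {f f′ g g′} → (∀ i → f i ≈ f′ i) → (∀ i → g i ≈ g′ i) → ∀ n → (f ∗ g) n ≈ (f′ ∗ g′) n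
  ∗-cong f≈f′ g≈g′ n = sum-cong n (λ i _ → *-cong (f≈f′ i) (g≈g′ (n ∸ i)))

  ∗-comm : ∀ f g n → (f ∗ g) n ≈ (g ∗ f) n
  ∗-comm f g n = trans (sum-reverse n _) (sum-cong n λ i i≤n →
    trans (*-comm _ _) (*-cong (reflexive (≡.cong g (ℕ.m∸[m∸n]≡n i≤n))) refl))

  ∗-assoc : ∀ f g h n → ((f ∗ g) ∗ h) n ≈ (f ∗ (g ∗ h)) n
  ∗-assoc f g h n = begin
    sum n (λ i → sum i (λ j → f j * g (i ∸ j)) * h (n ∸ i))
      ≈⟨ sum-cong n (λ i _ → *-distribʳ-sum i _ _) ⟩
    sum n (λ i → sum i (λ j → (f j * g (i ∸ j)) * h (n ∸ i)))
      ≈⟨ sum-triangle n (λ i j → (f j * g (i ∸ j)) * h (n ∸ i)) ⟩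
    sum n (λ j → sum (n ∸ j) (λ m → (f j * g (j ℕ.+ m ∸ j)) * h (n ∸ (j ℕ.+ m))))
      ≈⟨ sum-cong n (λ j _ → sum-cong (n ∸ j) (λ m _ → trans
           (*-cong (*-cong refl (reflexive (≡.cong g (ℕ.m+n∸m≡n j m))))
                   (reflexive (≡.cong h (≡.sym (ℕ.∸-+-assoc n j m)))))
           (*-assoc _ _ _))) ⟩
    sum n (λ j → sum (n ∸ j) (λ m → f j * (g m * h (n ∸ j ∸ m))))
      ≈⟨ sum-cong n (λ j _ → *-distribˡ-sum (n ∸ j) _ _) ⟨
    (f ∗ (g ∗ h)) n ∎

  ∗-distribˡ-+ : ∀ f g h n → (f ∗ (λ i → g i + h i)) n ≈ (f ∗ g) n + (f ∗ h) n
  ∗-distribˡ-+ f g h n = trans (sum-cong n (λ i _ → distribˡ _ _ _)) (sum-∙ n _ _)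

  ∗-constantˡ : ∀ g f n → (∀ i → g (suc i) ≈ 0#) → (g ∗ f) n ≈ g 0 * f n
  ∗-constantˡ g f zero    g₊≈0 = refl
  ∗-constantˡ g f (suc n) g₊≈0 = begin
    (g ∗ f) (suc n)                                    ≈⟨ sum-suc n _ ⟩
    g 0 * f (suc n) + sum n (λ i → g (suc i) * f (n ∸ i))
      ≈⟨ +-cong refl (sum-zero n _ (λ i _ → trans (*-cong (g₊≈0 i) refl) (zeroˡ _))) ⟩
    g 0 * f (suc n) + 0#                               ≈⟨ +-identityʳ _ ⟩
    g 0 * f (suc n)                                    ∎

  ∗-shiftˡ : ∀ g f n → g 0 ≈ 0# → (g ∗ f) (suc n) ≈ ((g ∘ suc) ∗ f) n
  ∗-shiftˡ g f n g₀≈0 = begin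
    (g ∗ f) (suc n)                       ≈⟨ sum-suc n _ ⟩
    g 0 * f (suc n) + ((g ∘ suc) ∗ f) n   ≈⟨ +-cong (trans (*-cong g₀≈0 refl) (zeroˡ _)) refl ⟩
    0# + ((g ∘ suc) ∗ f) n                ≈⟨ +-identityˡ _ ⟩
    ((g ∘ suc) ∗ f) n                     ∎

  ∗-identityˡ : ∀ f n → (one ∗ f) n ≈ f n
  ∗-identityˡ f n = trans (∗-constantˡ one f n (λ _ → refl)) (*-identityˡ _)

  powerSeriesRing : CommutativeRing c ℓ
  powerSeriesRing = record
    { Carrier = ℕ → Carrier
    ; _≈_     = λ f g → ∀ n → f n ≈ g n
    ; _+_     = λ f g n → f n + g n
    ; _*_     = _∗_
    ; -_      = λ f n → - f n
    ; 0#      = λ _ → 0#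
    ; 1#      = one
    ; isCommutativeRing = record
      { isRing = record
        { +-isAbelianGroup = record
          { isGroup = record
            { isMonoid = record
              { isSemigroup = record
                { isMagma = record
                  { isEquivalence = record
                    { refl  = λ _ → refl
                    ; sym   = λ f≈g n → sym (f≈g n)
                    ; trans = λ f≈g g≈h n → trans (f≈g n) (g≈h n) }
                  ; ∙-cong = λ f≈g h≈k n → +-cong (f≈g n) (h≈k n) }
                ; assoc = λ _ _ _ _ → +-assoc _ _ _ }
              ; identity = (λ _ _ → +-identityˡ _) , (λ _ _ → +-identityʳ _) }
            ; inverse = (λ _ _ → -‿inverseˡ _) , (λ _ _ → -‿inverseʳ _)
            ; ⁻¹-cong = λ f≈g n → -‿cong (f≈g n) }
          ; comm = λ _ _ _ → +-comm _ _ }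
        ; *-cong = ∗-cong
        ; *-assoc = ∗-assoc
        ; *-identity = ∗-identityˡ , (λ f n → trans (∗-comm f one n) (∗-identityˡ f n))
        ; distrib = ∗-distribˡ-+ , λ f g h n → begin
            ((λ i → g i + h i) ∗ f) n  ≈⟨ ∗-comm _ f n ⟩
            (f ∗ (λ i → g i + h i)) n  ≈⟨ ∗-distribˡ-+ f g h n ⟩
            (f ∗ g) n + (f ∗ h) n      ≈⟨ +-cong (∗-comm f g n) (∗-comm f h n) ⟩
            (g ∗ f) n + (h ∗ f) n      ∎ }
      ; *-comm = ∗-comm } }

-- Opened only now: these names clash with the structure fields used in the two modules above.
open ≡ using (refl; cong; cong₂; sym; trans; subst)
open import Data.Nat using (_+_; _*_; _≡ᵇ_; _<ᵇ_)
open Defs using (_≈_)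

-- Counting in lists

module ℕSum = RangeSum ℕ.+-0-commutativeMonoid
open ℕSum using (sum)

≡ᵇ⇒≡ : ∀ m n → (m ≡ᵇ n) ≡ true → m ≡ n
≡ᵇ⇒≡ m n m≡ᵇn = ℕ.≡ᵇ⇒≡ m n (Equivalence.from Bool.T-≡ m≡ᵇn)

≡⇒≡ᵇ : ∀ {m n} → m ≡ n → (m ≡ᵇ n) ≡ true
≡⇒≡ᵇ {m} {n} m≡n = Equivalence.to Bool.T-≡ (ℕ.≡⇒≡ᵇ m n m≡n)

≢⇒≢ᵇ : ∀ {m n} → m ≢ n → (m ≡ᵇ n) ≡ false
≢⇒≢ᵇ {m} {n} m≢n with m ≡ᵇ n in m≡ᵇn
... | true  = ⊥-elim (m≢n (≡ᵇ⇒≡ m n m≡ᵇn))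
... | false = refl

true⇔⇒≡ : ∀ {x y : Bool} → (x ≡ true → y ≡ true) → (y ≡ true → x ≡ true) → x ≡ y
true⇔⇒≡ {true}  {true}  _ _ = refl
true⇔⇒≡ {true}  {false} x⇒y _ = sym (x⇒y refl)
true⇔⇒≡ {false} {true}  _ y⇒x = y⇒x refl
true⇔⇒≡ {false} {false} _ _ = refl

fromBool : Bool → ℕ
fromBool true  = 1
fromBool false = 0

module _ {a} {A : Set a} where

  count : (A → Bool) → List A → ℕ
  count q xs = length (filter (λ x → q x Bool.≟ true) xs)

  count-∷ : ∀ q x xs → count q (x ∷ xs) ≡ fromBool (q x) + count q xs
  count-∷ q x xs with q x
  ... | true  = refl
  ... | false = refl

  count-cong : ∀ {q q′} xs → (∀ x → x ∈ xs → q x ≡ q′ x) → count q xs ≡ count q′ xs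
  count-cong []       _     = refl
  count-cong {q} {q′} (x ∷ xs) q≡q′ = begin
    count q (x ∷ xs)               ≡⟨ count-∷ q x xs ⟩
    fromBool (q x) + count q xs    ≡⟨ cong₂ _+_ (cong fromBool (q≡q′ x (here refl)))
                                                (count-cong xs (λ y → q≡q′ y ∘ there)) ⟩
    fromBool (q′ x) + count q′ xs  ≡⟨ count-∷ q′ x xs ⟨
    count q′ (x ∷ xs)              ∎
    where open ≡.≡-Reasoning

  count-zero : ∀ q xs → (∀ x → x ∈ xs → q x ≡ false) → count q xs ≡ 0
  count-zero q []       _      = refl
  count-zero q (x ∷ xs) q≡false rewrite count-∷ q x xs | q≡false x (here refl) =
    count-zero q xs (λ y → q≡false y ∘ there)

  count-++ : ∀ q xs ys → count q (xs ++ ys) ≡ count q xs + count q ys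
  count-++ q []       ys = refl
  count-++ q (x ∷ xs) ys rewrite count-∷ q x (xs ++ ys) | count-∷ q x xs | count-++ q xs ys =
    sym (ℕ.+-assoc (fromBool (q x)) _ _)

  count-↭ : ∀ q {xs ys} → xs ↭ ys → count q xs ≡ count q ys
  count-↭ q xs↭ys = Perm.↭-length (Perm.filter-↭ (λ x → q x Bool.≟ true) xs↭ys)

  count-filter : ∀ (p q : A → Bool) xs → count q (filter (λ x → p x Bool.≟ true) xs) ≡ count (λ x → p x ∧ q x) xs
  count-filter p q []       = refl
  count-filter p q (x ∷ xs) rewrite count-∷ (λ x → p x ∧ q x) x xs with p x
  ... | true  = trans (count-∷ q x _) (cong (λ m → fromBool (q x) + m) (count-filter p q xs))
  ... | false = count-filter p q xs

  fromBool-by-class : ∀ (q : ℕ → Bool) i → i ≤ 2 → fromBool (q i)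
    ≡ fromBool ((i ≡ᵇ 0) ∧ q 0) + fromBool ((i ≡ᵇ 1) ∧ q 1) + fromBool ((i ≡ᵇ 2) ∧ q 2)
  fromBool-by-class q 0 _ = sym (trans (ℕ.+-identityʳ _) (ℕ.+-identityʳ _))
  fromBool-by-class q 1 _ = sym (ℕ.+-identityʳ _)
  fromBool-by-class q 2 _ = refl
  fromBool-by-class q (suc (suc (suc _))) (s≤s (s≤s ()))

  count-by-class : ∀ (c : A → ℕ) (q : ℕ → A → Bool) xs → (∀ x → c x ≤ 2) →
    count (λ x → q (c x) x) xs
      ≡ count (λ x → (c x ≡ᵇ 0) ∧ q 0 x) xs + count (λ x → (c x ≡ᵇ 1) ∧ q 1 x) xs
        + count (λ x → (c x ≡ᵇ 2) ∧ q 2 x) xs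
  count-by-class c q []       _    = refl
  count-by-class c q (x ∷ xs) c≤2
    rewrite count-∷ (λ x → q (c x) x) x xs | count-∷ (λ x → (c x ≡ᵇ 0) ∧ q 0 x) x xs
          | count-∷ (λ x → (c x ≡ᵇ 1) ∧ q 1 x) x xs | count-∷ (λ x → (c x ≡ᵇ 2) ∧ q 2 x) x xs
          | count-by-class c q xs c≤2 | fromBool-by-class (λ i → q i x) (c x) (c≤2 x)
    = +-interchange₃ (d 0) (d 1) (d 2) (n 0) (n 1) (n 2)
    where
    d n : ℕ → ℕ
    d i = fromBool ((c x ≡ᵇ i) ∧ q i x)
    n i = count (λ x → (c x ≡ᵇ i) ∧ q i x) xs
    +-interchange₃ : ∀ d₀ d₁ d₂ a b c → d₀ + d₁ + d₂ + (a + b + c) ≡ d₀ + a + (d₁ + b) + (d₂ + c)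
    +-interchange₃ = solve-∀

count-map : ∀ {a b} {A : Set a} {B : Set b} q (f : A → B) xs → count q (map f xs) ≡ count (q ∘ f) xs
count-map q f []       = refl
count-map q f (x ∷ xs) rewrite count-∷ q (f x) (map f xs) | count-∷ (q ∘ f) x xs | count-map q f xs = refl

module _ {a b} {A : Set a} {B : Set b} where

  countPairs : (A → B → Bool) → List A → List B → ℕ
  countPairs g []       ys = 0
  countPairs g (x ∷ xs) ys = count (g x) ys + countPairs g xs ys

  count-cartesianProductWith : ∀ {c} {C : Set c} q (f : A → B → C) xs ys →
    count q (cartesianProductWith f xs ys) ≡ countPairs (λ x y → q (f x y)) xs ys
  count-cartesianProductWith q f []       ys = refl
  count-cartesianProductWith q f (x ∷ xs) ys
    rewrite count-++ q (map (f x) ys) (cartesianProductWith f xs ys)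
          | count-map q (f x) ys | count-cartesianProductWith q f xs ys = refl

  countPairs-cong : ∀ {g g′} xs ys → (∀ x y → x ∈ xs → y ∈ ys → g x y ≡ g′ x y) →
    countPairs g xs ys ≡ countPairs g′ xs ys
  countPairs-cong []       ys _     = refl
  countPairs-cong (x ∷ xs) ys g≡g′ =
    cong₂ _+_ (count-cong ys (λ y → g≡g′ x y (here refl))) (countPairs-cong xs ys (λ x y → g≡g′ x y ∘ there))

  countPairs-zero : ∀ g xs ys → (∀ x y → x ∈ xs → y ∈ ys → g x y ≡ false) → countPairs g xs ys ≡ 0
  countPairs-zero g []       ys _        = refl
  countPairs-zero g (x ∷ xs) ys g≡false
    rewrite count-zero (g x) ys (λ y → g≡false x y (here refl)) = countPairs-zero g xs ys (λ x y → g≡false x y ∘ there)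

  countPairs-singletonʳ : ∀ g xs y → countPairs g xs (y ∷ []) ≡ count (λ x → g x y) xs
  countPairs-singletonʳ g []       y = refl
  countPairs-singletonʳ g (x ∷ xs) y = begin
    count (g x) (y ∷ []) + countPairs g xs (y ∷ [])
      ≡⟨ cong₂ _+_ (count-∷ (g x) y []) (countPairs-singletonʳ g xs y) ⟩
    fromBool (g x y) + 0 + count (λ x → g x y) xs
      ≡⟨ cong (_+ count (λ x → g x y) xs) (ℕ.+-identityʳ _) ⟩
    fromBool (g x y) + count (λ x → g x y) xs
      ≡⟨ count-∷ (λ x → g x y) x xs ⟨
    count (λ x → g x y) (x ∷ xs) ∎
    where open ≡.≡-Reasoning

  count-+ˡ : ∀ a (G : B → ℕ) k ys → count (λ y → (a + G y) ≡ᵇ k) ys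
    ≡ sum k (λ j → fromBool (a ≡ᵇ j) * count (λ y → G y ≡ᵇ (k ∸ j)) ys)
  count-+ˡ a G k ys with a ℕ.≤? k
  ... | yes a≤k = begin
    count (λ y → (a + G y) ≡ᵇ k) ys                  ≡⟨ count-cong ys (λ y _ → true⇔⇒≡ (≡⇒≡ᵇ ∘ subtract) (≡⇒≡ᵇ ∘ add)) ⟩
    count (λ y → G y ≡ᵇ (k ∸ a)) ys                  ≡⟨ ℕ.*-identityˡ _ ⟨
    fromBool true * count (λ y → G y ≡ᵇ (k ∸ a)) ys
      ≡⟨ cong (λ b → fromBool b * count (λ y → G y ≡ᵇ (k ∸ a)) ys) (≡⇒≡ᵇ {a} refl) ⟨
    fromBool (a ≡ᵇ a) * N a                          ≡⟨ ℕSum.sum-single k a _ a≤k (λ j _ j≢a →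
                                                          cong (λ b → fromBool b * N j) (≢⇒≢ᵇ (j≢a ∘ sym))) ⟨
    sum k (λ j → fromBool (a ≡ᵇ j) * N j)            ∎
    where
    open ≡.≡-Reasoning
    N : ℕ → ℕ
    N j = count (λ y → G y ≡ᵇ (k ∸ j)) ys
    subtract : ∀ {y} → (a + G y ≡ᵇ k) ≡ true → G y ≡ k ∸ a
    subtract {y} e = trans (sym (ℕ.m+n∸m≡n a (G y))) (cong (_∸ a) (≡ᵇ⇒≡ (a + G y) k e))
    add : ∀ {y} → (G y ≡ᵇ k ∸ a) ≡ true → a + G y ≡ k
    add {y} e = trans (cong (λ m → a + m) (≡ᵇ⇒≡ (G y) (k ∸ a) e)) (ℕ.m+[n∸m]≡n a≤k)
  ... | no a≰k = trans
    (count-zero _ ys (λ y _ → ≢⇒≢ᵇ (λ e → a≰k (subst (a ≤_) e (ℕ.m≤m+n a (G y))))))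
    (sym (ℕSum.sum-zero k _ (λ j j≤k → cong (λ b → fromBool b * count (λ y → G y ≡ᵇ (k ∸ j)) ys)
                                            (≢⇒≢ᵇ {a} {j} (λ { refl → a≰k j≤k })))))

  countPairs-+ : ∀ (F : A → ℕ) (G : B → ℕ) k xs ys →
    countPairs (λ x y → (F x + G y) ≡ᵇ k) xs ys
      ≡ sum k (λ j → count (λ x → F x ≡ᵇ j) xs * count (λ y → G y ≡ᵇ (k ∸ j)) ys)
  countPairs-+ F G k []       ys = sym (ℕSum.sum-zero k _ (λ _ _ → refl))
  countPairs-+ F G k (x ∷ xs) ys = begin
    count (λ y → (F x + G y) ≡ᵇ k) ys + countPairs (λ x y → (F x + G y) ≡ᵇ k) xs ys
      ≡⟨ cong₂ _+_ (count-+ˡ (F x) G k ys) (countPairs-+ F G k xs ys) ⟩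
    sum k (λ j → fromBool (F x ≡ᵇ j) * N j) + sum k (λ j → count (λ x → F x ≡ᵇ j) xs * N j)
      ≡⟨ ℕSum.sum-∙ k _ _ ⟨
    sum k (λ j → fromBool (F x ≡ᵇ j) * N j + count (λ x → F x ≡ᵇ j) xs * N j)
      ≡⟨ ℕSum.sum-cong k (λ j _ → trans (sym (ℕ.*-distribʳ-+ (N j) (fromBool (F x ≡ᵇ j)) (count (λ x → F x ≡ᵇ j) xs)))
                                        (cong (_* N j) (sym (count-∷ (λ x → F x ≡ᵇ j) x xs)))) ⟩
    sum k (λ j → count (λ x → F x ≡ᵇ j) (x ∷ xs) * N j) ∎
    where
    open ≡.≡-Reasoning
    N : ℕ → ℕ
    N j = count (λ y → G y ≡ᵇ (k ∸ j)) ys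

-- The coefficients of xᵈ times the polynomial with coefficients f.
shift : ℕ → (ℕ → ℕ) → ℕ → ℕ
shift zero    f k       = f k
shift (suc d) f zero    = 0
shift (suc d) f (suc k) = shift d f k

count-+-shift : ∀ {a} {A : Set a} (p : A → Bool) (s : A → ℕ) d k xs →
  count (λ x → p x ∧ ((s x + d) ≡ᵇ k)) xs ≡ shift d (λ j → count (λ x → p x ∧ (s x ≡ᵇ j)) xs) k
count-+-shift p s zero    k       xs = count-cong xs (λ x _ → cong (λ m → p x ∧ (m ≡ᵇ k)) (ℕ.+-identityʳ (s x)))
count-+-shift p s (suc d) zero    xs = count-zero _ xs (λ x _ →
  trans (cong (λ m → p x ∧ (m ≡ᵇ 0)) (ℕ.+-suc (s x) d)) (Bool.∧-zeroʳ (p x)))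
count-+-shift p s (suc d) (suc k) xs = trans
  (count-cong xs (λ x _ → cong (λ m → p x ∧ (m ≡ᵇ suc k)) (ℕ.+-suc (s x) d)))
  (count-+-shift p s d k xs)

shift-cong : ∀ d {f g} → (∀ j → f j ≡ g j) → ∀ k → shift d f k ≡ shift d g k
shift-cong zero    f≡g k       = f≡g k
shift-cong (suc d) f≡g zero    = refl
shift-cong (suc d) f≡g (suc k) = shift-cong d f≡g k

-- The series ring ℤ[[x]][[t]]: a Series is a series in t whose coefficients are series in x.

module ℤ[[x]] = PowerSeries ℤ.+-*-commutativeRing
module ℤ[[x]][[t]] = PowerSeries ℤ[[x]].powerSeriesRing
module ℤSum = RangeSum ℤ.+-0-commutativeMonoid

sumTo≡sum : ∀ n f → sumTo n f ≡ ℤSum.sum n f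
sumTo≡sum zero    f = refl
sumTo≡sum (suc n) f = cong (ℤ._+ f (suc n)) (sumTo≡sum n f)

sum-at : ∀ n h k → ℤ[[x]][[t]].sum n h k ≡ ℤSum.sum n (λ i → h i k)
sum-at zero    h k = refl
sum-at (suc n) h k = cong (ℤ._+ h (suc n) k) (sum-at n h k)

⊛≈∗ : ∀ f g → f ⊛ g ≈ ℤ[[x]][[t]]._∗_ f g
⊛≈∗ f g n k = sym (begin
  ℤ[[x]][[t]]._∗_ f g n k                             ≡⟨ sum-at n _ k ⟩
  ℤSum.sum n (λ i → ℤ[[x]]._∗_ (f i) (g (n ∸ i)) k)   ≡⟨ ℤSum.sum-cong n (λ i _ → sym (sumTo≡sum k _)) ⟩
  ℤSum.sum n (λ i → sumTo k _)                        ≡⟨ sumTo≡sum n _ ⟨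
  (f ⊛ g) n k                                         ∎)
  where open ≡.≡-Reasoning

seriesRing : CommutativeRing _ _
seriesRing = record
  { Carrier = Series
  ; _≈_     = _≈_
  ; _+_     = _⊕_
  ; _*_     = _⊛_
  ; -_      = λ f n k → ℤ.- f n k
  ; 0#      = λ _ _ → + 0
  ; 1#      = ℤ[[x]][[t]].one
  ; isCommutativeRing = record
    { isRing = record
      { +-isAbelianGroup = T.+-isAbelianGroup
      ; *-cong   = λ {f} {f′} {g} {g′} f≈f′ g≈g′ →
          via f g (T.*-cong f≈f′ g≈g′) (⊛≈∗ f′ g′)
      ; *-assoc  = λ f g h →
          via (f ⊛ g) h (T.trans (T.*-cong (⊛≈∗ f g) (T.refl {h})) (T.trans (T.*-assoc f g h)
                        (T.*-cong (T.refl {f}) (T.sym (⊛≈∗ g h))))) (⊛≈∗ f (g ⊛ h))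
      ; *-identity = (λ f → T.trans (⊛≈∗ ℤ[[x]][[t]].one f) (proj₁ T.*-identity f))
                   , (λ f → T.trans (⊛≈∗ f ℤ[[x]][[t]].one) (proj₂ T.*-identity f))
      ; distrib  = (λ f g h → via f (g ⊕ h) (proj₁ T.distrib f g h) (T.+-cong (⊛≈∗ f g) (⊛≈∗ f h)))
                 , (λ f g h → via (g ⊕ h) f (proj₂ T.distrib f g h) (T.+-cong (⊛≈∗ g f) (⊛≈∗ h f)))
      }
    ; *-comm = λ f g → via f g (T.*-comm f g) (⊛≈∗ g f) } }
  where
  module T = CommutativeRing ℤ[[x]][[t]].powerSeriesRing
  via : ∀ f g {u v} → ℤ[[x]][[t]]._∗_ f g ≈ u → v ≈ u → f ⊛ g ≈ v
  via f g fg≈u v≈u = T.trans (⊛≈∗ f g) (T.trans fg≈u (T.sym v≈u))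

tS⊛-zero : ∀ f k → (tS ⊛ f) 0 k ≡ + 0
tS⊛-zero f k = trans (⊛≈∗ tS f 0 k) (ℤ[[x]].sum-zero k _ (λ j _ → ℤ.*-zeroˡ (f 0 (k ∸ j))))

tS⊛-suc : ∀ f n k → (tS ⊛ f) (suc n) k ≡ f n k
tS⊛-suc f n k = begin
  (tS ⊛ f) (suc n) k                   ≡⟨ ⊛≈∗ tS f (suc n) k ⟩
  ℤ[[x]][[t]]._∗_ tS f (suc n) k       ≡⟨ ℤ[[x]][[t]].∗-shiftˡ tS f n (λ _ → refl) k ⟩
  ℤ[[x]][[t]]._∗_ (tS ∘ suc) f n k     ≡⟨ ℤ[[x]][[t]].∗-constantˡ (tS ∘ suc) f n (λ _ _ → refl) k ⟩
  ℤ[[x]]._∗_ (tS 1) (f n) k            ≡⟨ ℤ[[x]].∗-cong {tS 1} {ℤ[[x]].one} {f n} tS₁≈one (λ _ → refl) k ⟩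
  ℤ[[x]]._∗_ ℤ[[x]].one (f n) k        ≡⟨ ℤ[[x]].∗-identityˡ (f n) k ⟩
  f n k                                ∎
  where
  open ≡.≡-Reasoning
  tS₁≈one : ∀ j → tS 1 j ≡ ℤ[[x]].one j
  tS₁≈one zero    = refl
  tS₁≈one (suc j) = refl

xS⊛-at : ∀ f n k → (xS ⊛ f) n k ≡ ℤ[[x]]._∗_ (xS 0) (f n) k
xS⊛-at f n k = trans (⊛≈∗ xS f n k) (ℤ[[x]][[t]].∗-constantˡ xS f n (λ _ _ → refl) k)

xS⊛-zero : ∀ f n → (xS ⊛ f) n 0 ≡ + 0
xS⊛-zero f n = xS⊛-at f n 0

xS⊛-suc : ∀ f n k → (xS ⊛ f) n (suc k) ≡ f n k
xS⊛-suc f n k = begin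
  (xS ⊛ f) n (suc k)                   ≡⟨ xS⊛-at f n (suc k) ⟩
  ℤ[[x]]._∗_ (xS 0) (f n) (suc k)      ≡⟨ ℤ[[x]].∗-shiftˡ (xS 0) (f n) k refl ⟩
  ℤ[[x]]._∗_ (xS 0 ∘ suc) (f n) k      ≡⟨ ℤ[[x]].∗-constantˡ (xS 0 ∘ suc) (f n) k (λ _ → refl) ⟩
  + 1 ℤ.* f n k                        ≡⟨ ℤ.*-identityˡ (f n k) ⟩
  f n k                                ∎
  where open ≡.≡-Reasoning

sumTo-+ : ∀ n (f : ℕ → ℕ) → sumTo n (λ i → + f i) ≡ + ℕSum.sum n f
sumTo-+ zero    f = refl
sumTo-+ (suc n) f = trans (cong (ℤ._+ + f (suc n)) (sumTo-+ n f)) (sym (ℤ.pos-+ (ℕSum.sum n f) (f (suc n))))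

sumTo-cong : ∀ n {u v : ℕ → ℤ} → (∀ i → u i ≡ v i) → sumTo n u ≡ sumTo n v
sumTo-cong zero    u≡v = u≡v 0
sumTo-cong (suc n) u≡v = cong₂ ℤ._+_ (sumTo-cong n u≡v) (u≡v (suc n))

⊛-+ : ∀ (f g : ℕ → ℕ → ℕ) n k → ((λ n k → + f n k) ⊛ (λ n k → + g n k)) n k
  ≡ + ℕSum.sum n (λ i → ℕSum.sum k (λ j → f i j * g (n ∸ i) (k ∸ j)))
⊛-+ f g n k = trans
  (sumTo-cong n (λ i → trans (sumTo-cong k (λ j → sym (ℤ.pos-* (f i j) (g (n ∸ i) (k ∸ j)))))
                             (sumTo-+ k (λ j → f i j * g (n ∸ i) (k ∸ j)))))
  (sumTo-+ n (λ i → ℕSum.sum k (λ j → f i j * g (n ∸ i) (k ∸ j))))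

xS⊛-+ : ∀ (f : ℕ → ℕ → ℕ) n k → (xS ⊛ (λ n k → + f n k)) n k ≡ + shift 1 (f n) k
xS⊛-+ f n zero    = xS⊛-zero (λ n k → + f n k) n
xS⊛-+ f n (suc k) = xS⊛-suc (λ n k → + f n k) n k

const-⊛ : ∀ c f → const c ⊛ f ≈ (λ n k → c ℤ.* f n k)
const-⊛ c f n k = begin
  (const c ⊛ f) n k                          ≡⟨ ⊛≈∗ (const c) f n k ⟩
  ℤ[[x]][[t]]._∗_ (const c) f n k            ≡⟨ ℤ[[x]][[t]].∗-constantˡ (const c) f n (λ _ _ → refl) k ⟩
  ℤ[[x]]._∗_ (const c 0) (f n) k             ≡⟨ ℤ[[x]].∗-constantˡ (const c 0) (f n) k (λ _ → refl) ⟩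
  c ℤ.* f n k                                ∎
  where open ≡.≡-Reasoning

const-homomorphism : CommutativeRing.rawRing ℤ.+-*-commutativeRing
                       -Raw-AlmostCommutative⟶ fromCommutativeRing seriesRing
const-homomorphism = record
  { ⟦_⟧    = const
  ; +-homo = λ a b → λ { zero zero → refl ; zero (suc k) → refl ; (suc n) k → refl }
  ; *-homo = λ a b n k → sym (trans (const-⊛ a (const b) n k) (scale a b n k))
  ; -‿homo = λ a → λ { zero zero → refl ; zero (suc k) → refl ; (suc n) k → refl }
  ; 0-homo = λ { zero zero → refl ; zero (suc k) → refl ; (suc n) k → refl }
  ; 1-homo = λ { zero zero → refl ; zero (suc k) → refl ; (suc n) k → refl } }
  where
  scale : ∀ a b n k → a ℤ.* const b n k ≡ const (a ℤ.* b) n k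
  scale a b zero    zero    = refl
  scale a b zero    (suc k) = ℤ.*-zeroʳ a
  scale a b (suc n) k       = ℤ.*-zeroʳ a

const-≟ : ∀ a b → Maybe (const a ≈ const b)
const-≟ a b with a ℤ.≟ b
... | yes refl = just (λ _ _ → refl)
... | no _     = nothing

module SeriesSolver = RingSolver (CommutativeRing.rawRing ℤ.+-*-commutativeRing)
  (fromCommutativeRing seriesRing) const-homomorphism const-≟

-- Solving the functional equations

open CommutativeRing seriesRing using (0#; -_; *-cong; zeroʳ) renaming (refl to ≈-refl; trans to ≈-trans)

⊖≈0⇒≈ : ∀ {u v} → u ⊖ v ≈ 0# → u ≈ v
⊖≈0⇒≈ {u} {v} u-v≈0 n k = ℤ.i-j≡0⇒i≡j (u n k) (v n k) (u-v≈0 n k)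

≈⇒⊖≈0 : ∀ {u v} → u ≈ v → u ⊖ v ≈ 0#
≈⇒⊖≈0 u≈v n k = ℤ.i≡j⇒i-j≡0 (u≈v n k)

*-vanishes : ∀ c {d} → d ≈ 0# → c ⊛ d ≈ 0#
*-vanishes c d≈0 = ≈-trans (*-cong (≈-refl {c}) d≈0) (zeroʳ c)

+-vanishes : ∀ {d e} → d ≈ 0# → e ≈ 0# → d ⊕ e ≈ 0#
+-vanishes d≈0 e≈0 n k = cong₂ ℤ._+_ (d≈0 n k) (e≈0 n k)

-‿vanishes : ∀ {d} → d ≈ 0# → - d ≈ 0#
-‿vanishes d≈0 n k = cong ℤ.-_ (d≈0 n k)

open SeriesSolver using (Polynomial; solve; _:=_; con; _:+_; _:-_; _:*_; :-_)

P⟨_,_⟩ Q⟨_,_⟩ R⟨_,_⟩ : ∀ {m} → Polynomial m → Polynomial m → Polynomial m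
P⟨ t , x ⟩ = con (+ 1) :+ t :+ t :* t :- t :* x :- t :* t :* x :- t :* t :* t :* x :+ t :* t :* t :* x :* x
Q⟨ t , x ⟩ = t :* (con (+ 1) :- x :* t) :+ x :* x :* t :* t
R⟨ t , x ⟩ = (con (+ 1) :+ t) :* (con (+ 1) :- x :* t) :+ x :* x :* t :* t

-- Each identity below holds because the difference of its two sides is an explicit combination of
-- the differences of the two sides of the hypotheses.
module FunctionalEquations
  (A B B₁ B₂ A⁺ : Series)
  (A-rec  : A ⊕ tS ⊛ A ≈ 1S ⊕ tS ⊛ A⁺ ⊕ tS ⊛ (A⁺ ⊛ A))
  (B-rec  : B ≈ tS ⊛ A⁺)
  (B₁-rec : B₁ ≈ tS ⊛ (xS ⊛ (B₁ ⊕ xS ⊛ B₂)))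
  (B₂-rec : B₂ ≈ tS ⊛ (A ⊖ B))
  (B-split : B ≈ B₁ ⊕ B₂)
  where

  R⊛B≈Q⊛A : Rp ⊛ B ≈ Qp ⊛ A
  R⊛B≈Q⊛A = ⊖≈0⇒≈ (≈-trans combination
    (+-vanishes (+-vanishes (≈⇒⊖≈0 B₁-rec) (*-vanishes (1S ⊖ tS ⊛ xS ⊕ tS ⊛ xS ⊛ xS) (≈⇒⊖≈0 B₂-rec)))
                (*-vanishes (1S ⊖ tS ⊛ xS) (≈⇒⊖≈0 B-split))))
    where
    combination : Rp ⊛ B ⊖ Qp ⊛ A
      ≈ (B₁ ⊖ tS ⊛ (xS ⊛ (B₁ ⊕ xS ⊛ B₂))) ⊕ (1S ⊖ tS ⊛ xS ⊕ tS ⊛ xS ⊛ xS) ⊛ (B₂ ⊖ tS ⊛ (A ⊖ B))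
        ⊕ (1S ⊖ tS ⊛ xS) ⊛ (B ⊖ (B₁ ⊕ B₂))
    combination = solve 6 (λ t x A B B₁ B₂ →
      R⟨ t , x ⟩ :* B :- Q⟨ t , x ⟩ :* A
        := (B₁ :- t :* (x :* (B₁ :+ x :* B₂))) :+ (con (+ 1) :- t :* x :+ t :* x :* x) :* (B₂ :- t :* (A :- B))
           :+ (con (+ 1) :- t :* x) :* (B :- (B₁ :+ B₂)))
      ≈-refl tS xS A B B₁ B₂

  quadratic : Qp ⊛ A ⊛ A ⊖ Pp ⊛ A ⊕ Rp ≈ 0#
  quadratic = ≈-trans combination
    (+-vanishes (+-vanishes (+-vanishes (+-vanishes (-‿vanishes (*-vanishes Rp (≈⇒⊖≈0 A-rec)))
      (*-vanishes Rp (≈⇒⊖≈0 B-rec))) (*-vanishes (Rp ⊛ A) (≈⇒⊖≈0 B-rec)))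
      (-‿vanishes (*-vanishes A (≈⇒⊖≈0 R⊛B≈Q⊛A)))) (-‿vanishes (≈⇒⊖≈0 R⊛B≈Q⊛A)))
    where
    combination : Qp ⊛ A ⊛ A ⊖ Pp ⊛ A ⊕ Rp
      ≈ - (Rp ⊛ (A ⊕ tS ⊛ A ⊖ (1S ⊕ tS ⊛ A⁺ ⊕ tS ⊛ (A⁺ ⊛ A)))) ⊕ Rp ⊛ (B ⊖ tS ⊛ A⁺)
        ⊕ Rp ⊛ A ⊛ (B ⊖ tS ⊛ A⁺) ⊖ A ⊛ (Rp ⊛ B ⊖ Qp ⊛ A) ⊖ (Rp ⊛ B ⊖ Qp ⊛ A)
    combination = solve 5 (λ t x A B A⁺ →
      Q⟨ t , x ⟩ :* A :* A :- P⟨ t , x ⟩ :* A :+ R⟨ t , x ⟩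
        := :- (R⟨ t , x ⟩ :* (A :+ t :* A :- (con (+ 1) :+ t :* A⁺ :+ t :* (A⁺ :* A)))) :+ R⟨ t , x ⟩ :* (B :- t :* A⁺)
           :+ R⟨ t , x ⟩ :* A :* (B :- t :* A⁺) :- A :* (R⟨ t , x ⟩ :* B :- Q⟨ t , x ⟩ :* A)
           :- (R⟨ t , x ⟩ :* B :- Q⟨ t , x ⟩ :* A))
      ≈-refl tS xS A B A⁺

  root : Series
  root = Pp ⊖ const (+ 2) ⊛ Qp ⊛ A

  root²≈F : root ⊛ root ≈ Fp
  root²≈F = ⊖≈0⇒≈ (≈-trans expansion (*-vanishes (const (+ 4) ⊛ Qp) quadratic))
    where
    expansion : root ⊛ root ⊖ Fp ≈ const (+ 4) ⊛ Qp ⊛ (Qp ⊛ A ⊛ A ⊖ Pp ⊛ A ⊕ Rp)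
    expansion = solve 3 (λ t x A →
      (P⟨ t , x ⟩ :- con (+ 2) :* Q⟨ t , x ⟩ :* A) :* (P⟨ t , x ⟩ :- con (+ 2) :* Q⟨ t , x ⟩ :* A)
        :- (P⟨ t , x ⟩ :* P⟨ t , x ⟩ :- con (+ 4) :* R⟨ t , x ⟩ :* Q⟨ t , x ⟩)
        := con (+ 4) :* Q⟨ t , x ⟩ :* (Q⟨ t , x ⟩ :* A :* A :- P⟨ t , x ⟩ :* A :+ R⟨ t , x ⟩))
      ≈-refl tS xS A

  2QA≈P-root : const (+ 2) ⊛ Qp ⊛ A ≈ Pp ⊖ root
  2QA≈P-root = solve 3 (λ t x A →
      con (+ 2) :* Q⟨ t , x ⟩ :* A := P⟨ t , x ⟩ :- (P⟨ t , x ⟩ :- con (+ 2) :* Q⟨ t , x ⟩ :* A))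
    ≈-refl tS xS A

  -- P ≡ 1 and Q ≡ 0 modulo t.
  root-t⁰ : ∀ k → root 0 k ≡ 1S 0 k
  root-t⁰ k = trans (1+t⊛W 0 k) (trans (cong (λ z → 1S 0 k ℤ.+ z) (tS⊛-zero W k)) (ℤ.+-identityʳ (1S 0 k)))
    where
    W : Series
    W = 1S ⊕ tS ⊖ xS ⊖ tS ⊛ xS ⊖ tS ⊛ tS ⊛ xS ⊕ tS ⊛ tS ⊛ xS ⊛ xS ⊖ const (+ 2) ⊛ (1S ⊖ xS ⊛ tS ⊕ xS ⊛ xS ⊛ tS) ⊛ A
    1+t⊛W : root ≈ 1S ⊕ tS ⊛ W
    1+t⊛W = solve 3 (λ t x A →
      P⟨ t , x ⟩ :- con (+ 2) :* Q⟨ t , x ⟩ :* A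
        := con (+ 1) :+ t :* (con (+ 1) :+ t :- x :- t :* x :- t :* t :* x :+ t :* t :* x :* x
                              :- con (+ 2) :* (con (+ 1) :- x :* t :+ x :* x :* t) :* A))
      ≈-refl tS xS A

-- Permutations avoiding 132

true≢false : true ≢ false
true≢false ()

∨-trueˡ : ∀ {x} y → x ≡ true → x ∨ y ≡ true
∨-trueˡ y refl = refl

∨-trueʳ : ∀ x {y} → y ≡ true → x ∨ y ≡ true
∨-trueʳ x refl = Bool.∨-zeroʳ x

∨-false : ∀ {x y} → x ≡ false → y ≡ false → x ∨ y ≡ false
∨-false refl refl = refl

∨-true⁻ : ∀ x {y} → x ∨ y ≡ true → x ≡ true ⊎ y ≡ true
∨-true⁻ true  _      = inj₁ refl
∨-true⁻ false y≡true = inj₂ y≡true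

<⇒<ᵇ : ∀ {m n} → m < n → (m <ᵇ n) ≡ true
<⇒<ᵇ m<n = Equivalence.to Bool.T-≡ (ℕ.<⇒<ᵇ m<n)

≤⇒≮ᵇ : ∀ {m n} → n ≤ m → (m <ᵇ n) ≡ false
≤⇒≮ᵇ {m} {n} n≤m with m <ᵇ n in m<ᵇn
... | true  = ⊥-elim (ℕ.<⇒≱ (ℕ.<ᵇ⇒< m n (Equivalence.from Bool.T-≡ m<ᵇn)) n≤m)
... | false = refl

module _ (p : ℕ → Bool) where

  any-true : ∀ {x} xs → x ∈ xs → p x ≡ true → any p xs ≡ true
  any-true (y ∷ xs) (here refl) px≡true = ∨-trueˡ (any p xs) px≡true
  any-true (y ∷ xs) (there x∈)  px≡true = ∨-trueʳ (p y) (any-true xs x∈ px≡true)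

  any-false : ∀ xs → All (λ x → p x ≡ false) xs → any p xs ≡ false
  any-false []       []           = refl
  any-false (x ∷ xs) (px ∷ pxs) = ∨-false px (any-false xs pxs)

  any-++ : ∀ xs ys → any p (xs ++ ys) ≡ any p xs ∨ any p ys
  any-++ []       ys = refl
  any-++ (x ∷ xs) ys = trans (cong (p x ∨_) (any-++ xs ys)) (sym (Bool.∨-assoc (p x) _ _))

InRange : ℕ → ℕ → Set
InRange n a = 1 ≤ a × a ≤ n

alphabet⁻ : ∀ {n a} → a ∈ map suc (upTo n) → InRange n a
alphabet⁻ a∈ with ∈.∈-map⁻ suc a∈
... | i , i∈ , refl = s≤s z≤n , ∈.∈-upTo⁻ i∈

alphabet⁺ : ∀ {n a} → InRange n a → a ∈ map suc (upTo n)
alphabet⁺ {a = suc a} (s≤s z≤n , a<n) = ∈.∈-map⁺ suc (∈.∈-upTo⁺ a<n)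

words-suc : ∀ n m → words n (suc m) ≡ cartesianProductWith _∷_ (map suc (upTo n)) (words n m)
words-suc n m = go (map suc (upTo n))
  where
  go : ∀ as → concatMap (λ a → map (a ∷_) (words n m)) as ≡ cartesianProductWith _∷_ as (words n m)
  go []       = refl
  go (a ∷ as) = cong (map (a ∷_) (words n m) ++_) (go as)

∈-words⁻ : ∀ n m {σ} → σ ∈ words n m → length σ ≡ m × All (InRange n) σ
∈-words⁻ n zero    (here refl) = refl , []
∈-words⁻ n (suc m) σ∈ rewrite words-suc n m
  with a , w , a∈ , w∈ , refl ← ∈.∈-cartesianProductWith⁻ _∷_ (map suc (upTo n)) (words n m) σ∈
  with length≡ , inRange ← ∈-words⁻ n m w∈
  = cong suc length≡ , alphabet⁻ a∈ ∷ inRange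

∈-words⁺ : ∀ n m {σ} → length σ ≡ m → All (InRange n) σ → σ ∈ words n m
∈-words⁺ n zero    {[]}    refl []              = here refl
∈-words⁺ n (suc m) {a ∷ σ} length≡ (a∈ ∷ σ∈) rewrite words-suc n m =
  ∈.∈-cartesianProductWith⁺ _∷_ (alphabet⁺ a∈) (∈-words⁺ n m (ℕ.suc-injective length≡) σ∈)

words-unique : ∀ n m → Unique (words n m)
words-unique n zero    = [] ∷ []
words-unique n (suc m) rewrite words-suc n m =
  Unique.cartesianProductWith⁺ _∷_ List.∷-injective
    (Unique.map⁺ ℕ.suc-injective (Unique.upTo⁺ n)) (words-unique n m)

not-any-≡ᵇ⁻ : ∀ a xs → not (any (a ≡ᵇ_) xs) ≡ true → All (a ≢_) xs
not-any-≡ᵇ⁻ a []       _ = []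
not-any-≡ᵇ⁻ a (b ∷ xs) h with a ≡ᵇ b in a≡ᵇb
not-any-≡ᵇ⁻ a (b ∷ xs) () | true
... | false = (λ a≡b → true≢false (trans (sym (≡⇒≡ᵇ a≡b)) a≡ᵇb)) ∷ not-any-≡ᵇ⁻ a xs h

not-any-≡ᵇ⁺ : ∀ a xs → All (a ≢_) xs → not (any (a ≡ᵇ_) xs) ≡ true
not-any-≡ᵇ⁺ a []       []            = refl
not-any-≡ᵇ⁺ a (b ∷ xs) (a≢b ∷ a≢xs) with a ≡ᵇ b in a≡ᵇb
... | true  = ⊥-elim (a≢b (≡ᵇ⇒≡ a b a≡ᵇb))
... | false = not-any-≡ᵇ⁺ a xs a≢xs

distinct⇒Unique : ∀ σ → distinct σ ≡ true → Unique σ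
distinct⇒Unique []      _ = []
distinct⇒Unique (a ∷ σ) h = not-any-≡ᵇ⁻ a σ (Bool.∧-conicalˡ _ _ h) ∷ distinct⇒Unique σ (Bool.∧-conicalʳ _ _ h)

Unique⇒distinct : ∀ σ → Unique σ → distinct σ ≡ true
Unique⇒distinct []      _              = refl
Unique⇒distinct (a ∷ σ) (a∉σ ∷ unique) rewrite not-any-≡ᵇ⁺ a σ a∉σ = Unique⇒distinct σ unique

record Is132Avoider (n : ℕ) (σ : List ℕ) : Set where
  field
    length≡ : length σ ≡ n
    inRange : All (InRange n) σ
    unique  : Unique σ
    avoids  : avoids132 σ ≡ true

S132 : ℕ → List (List ℕ)
S132 n = filter (λ σ → avoids132 σ Bool.≟ true) (S n)

∈-S132⁻ : ∀ {n σ} → σ ∈ S132 n → Is132Avoider n σ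
∈-S132⁻ {n} {σ} σ∈
  with σ∈S , avoids ← ∈.∈-filter⁻ (λ σ → avoids132 σ Bool.≟ true) {xs = S n} σ∈
  with σ∈words , distinct ← ∈.∈-filter⁻ (λ σ → distinct σ Bool.≟ true) {xs = words n n} σ∈S
  with length≡ , inRange ← ∈-words⁻ n n σ∈words
  = record { length≡ = length≡ ; inRange = inRange ; unique = distinct⇒Unique σ distinct ; avoids = avoids }

∈-S132⁺ : ∀ {n σ} → Is132Avoider n σ → σ ∈ S132 n
∈-S132⁺ {n} {σ} σ-avoider = ∈.∈-filter⁺ (λ σ → avoids132 σ Bool.≟ true) {xs = S n}
  (∈.∈-filter⁺ (λ σ → distinct σ Bool.≟ true) {xs = words n n} (∈-words⁺ n n length≡ inRange) (Unique⇒distinct σ unique))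
  avoids
  where open Is132Avoider σ-avoider

S132-unique : ∀ n → Unique (S132 n)
S132-unique n = Unique.filter⁺ (λ σ → avoids132 σ Bool.≟ true)
  (Unique.filter⁺ (λ σ → distinct σ Bool.≟ true) (words-unique n n))

pat132From-++ˡ : ∀ a xs ys → pat132From a xs ≡ true → pat132From a (xs ++ ys) ≡ true
pat132From-++ˡ a (b ∷ xs) ys h with ∨-true⁻ (any (λ c → (a <ᵇ c) ∧ (c <ᵇ b)) xs) h
... | inj₁ found = ∨-trueˡ _ (trans (any-++ _ xs ys) (cong (_∨ _) found))
... | inj₂ later = ∨-trueʳ _ (pat132From-++ˡ a xs ys later)

contains132-++ˡ : ∀ xs ys → contains132 xs ≡ true → contains132 (xs ++ ys) ≡ true
contains132-++ˡ (a ∷ xs) ys h with ∨-true⁻ (pat132From a xs) h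
... | inj₁ found = ∨-trueˡ _ (pat132From-++ˡ a xs ys found)
... | inj₂ later = ∨-trueʳ _ (contains132-++ˡ xs ys later)

contains132-++ʳ : ∀ xs ys → contains132 ys ≡ true → contains132 (xs ++ ys) ≡ true
contains132-++ʳ []       ys h = h
contains132-++ʳ (a ∷ xs) ys h = ∨-trueʳ _ (contains132-++ʳ xs ys h)

pat132From-max : ∀ {a b N} ws ys → b ∈ ys → a < b → b < N → pat132From a (ws ++ N ∷ ys) ≡ true
pat132From-max []       ys b∈ a<b b<N =
  ∨-trueˡ _ (any-true _ ys b∈ (cong₂ _∧_ (<⇒<ᵇ a<b) (<⇒<ᵇ b<N)))
pat132From-max (w ∷ ws) ys b∈ a<b b<N = ∨-trueʳ _ (pat132From-max ws ys b∈ a<b b<N)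

-- a, N, b form a 132 pattern.
contains132-max : ∀ {a b N} xs ys → a ∈ xs → b ∈ ys → a < b → b < N → contains132 (xs ++ N ∷ ys) ≡ true
contains132-max (x ∷ xs) ys (here refl) b∈ a<b b<N = ∨-trueˡ _ (pat132From-max xs ys b∈ a<b b<N)
contains132-max (x ∷ xs) ys (there a∈)  b∈ a<b b<N = ∨-trueʳ _ (contains132-max xs ys a∈ b∈ a<b b<N)

pat132From-below : ∀ a xs → All (_≤ a) xs → pat132From a xs ≡ false
pat132From-below a []       _          = refl
pat132From-below a (b ∷ xs) (_ ∷ xs≤a) =
  ∨-false (any-false (λ c → (a <ᵇ c) ∧ (c <ᵇ b)) xs (All.map (λ {c} c≤a → cong (_∧ (c <ᵇ b)) (≤⇒≮ᵇ c≤a)) xs≤a))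
          (pat132From-below a xs xs≤a)

pat132From-max-free : ∀ {N} a ws ys → pat132From a ws ≡ false → All (_< N) ws → All (_< a) ys →
  pat132From a (ws ++ N ∷ ys) ≡ false
pat132From-max-free {N} a []       ys _ _ ys<a =
  ∨-false (any-false (λ c → (a <ᵇ c) ∧ (c <ᵇ N)) ys (All.map (λ {c} c<a → cong (_∧ (c <ᵇ N)) (≤⇒≮ᵇ (ℕ.<⇒≤ c<a))) ys<a))
          (pat132From-below a ys (All.map ℕ.<⇒≤ ys<a))
pat132From-max-free {N} a (w ∷ ws) ys h (w<N ∷ ws<N) ys<a
  rewrite any-++ (λ c → (a <ᵇ c) ∧ (c <ᵇ w)) ws (N ∷ ys) =
  ∨-false (∨-false (Bool.∨-conicalˡ (any (λ c → (a <ᵇ c) ∧ (c <ᵇ w)) ws) _ h)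
                   (∨-false (trans (cong ((a <ᵇ N) ∧_) (≤⇒≮ᵇ (ℕ.<⇒≤ w<N))) (Bool.∧-zeroʳ _))
                            (any-false (λ c → (a <ᵇ c) ∧ (c <ᵇ w)) ys
                                       (All.map (λ {c} c<a → cong (_∧ (c <ᵇ w)) (≤⇒≮ᵇ (ℕ.<⇒≤ c<a))) ys<a))))
          (pat132From-max-free a ws ys (Bool.∨-conicalʳ _ _ h) ws<N ys<a)

-- If everything before the maximum exceeds everything after it, a 132 pattern lies on one side.
avoids132-max : ∀ {N} xs ys → contains132 xs ≡ false → contains132 ys ≡ false →
  All (_< N) xs → All (_< N) ys → All (λ a → All (_< a) ys) xs → contains132 (xs ++ N ∷ ys) ≡ false
avoids132-max {N} []       ys _  ys-avoids _ ys<N _ = ∨-false (pat132From-below N ys (All.map ℕ.<⇒≤ ys<N)) ys-avoids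
avoids132-max     (x ∷ xs) ys h ys-avoids (x<N ∷ xs<N) ys<N (ys<x ∷ ys<xs) =
  ∨-false (pat132From-max-free x xs ys (Bool.∨-conicalˡ _ _ h) xs<N ys<x)
          (avoids132-max xs ys (Bool.∨-conicalʳ _ _ h) ys-avoids xs<N ys<N ys<xs)

module _ (c : ℕ) where

  <ᵇ-+ : ∀ a b → ((a + c) <ᵇ (b + c)) ≡ (a <ᵇ b)
  <ᵇ-+ a b rewrite ℕ.+-comm a c | ℕ.+-comm b c = go c
    where
    go : ∀ c → ((c + a) <ᵇ (c + b)) ≡ (a <ᵇ b)
    go zero    = refl
    go (suc c) = go c

  pat132From-+ : ∀ a xs → pat132From (a + c) (map (_+ c) xs) ≡ pat132From a xs
  pat132From-+ a []       = refl
  pat132From-+ a (b ∷ xs) rewrite pat132From-+ a xs = cong (_∨ pat132From a xs) (any-shift xs)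
    where
    any-shift : ∀ xs → any (λ d → ((a + c) <ᵇ d) ∧ (d <ᵇ (b + c))) (map (_+ c) xs)
                     ≡ any (λ d → (a <ᵇ d) ∧ (d <ᵇ b)) xs
    any-shift []       = refl
    any-shift (d ∷ xs) rewrite <ᵇ-+ a d | <ᵇ-+ d b | any-shift xs = refl

  contains132-+ : ∀ xs → contains132 (map (_+ c) xs) ≡ contains132 xs
  contains132-+ []       = refl
  contains132-+ (a ∷ xs) rewrite pat132From-+ a xs | contains132-+ xs = refl

-- Decomposition at the maximum: σ = α′ (n+1) β, with α′ the shift of α above β

Unique-++⁻ : ∀ {A : Set} (xs : List A) {ys} → Unique (xs ++ ys) →
  Unique xs × Unique ys × (∀ {a b} → a ∈ xs → b ∈ ys → a ≢ b)
Unique-++⁻ []       ys!           = [] , ys! , λ ()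
Unique-++⁻ (x ∷ xs) (x∉ ∷ xsys!) with xs! , ys! , xs≢ys ← Unique-++⁻ xs xsys! =
  All.++⁻ˡ xs x∉ ∷ xs! , ys! , λ where
    (here refl) b∈ → All.lookup (All.++⁻ʳ xs x∉) b∈
    (there a∈)  b∈ → xs≢ys a∈ b∈

Unique-⊆⇒length≤ : ∀ {A : Set} {xs ys : List A} → Unique xs → xs ⊆ ys → length xs ≤ length ys
Unique-⊆⇒length≤ {xs = []}     _            _     = z≤n
Unique-⊆⇒length≤ {xs = x ∷ xs} (x∉xs ∷ xs!) xs⊆ys
  with ys₁ , ys₂ , refl ← ∈.∈-∃++ (xs⊆ys (here refl)) =
  subst (suc (length xs) ≤_) (sym (List.length-++-sucʳ ys₁ x ys₂))
        (s≤s (Unique-⊆⇒length≤ xs! (λ {y} y∈xs → drop-x (All.lookup x∉xs y∈xs) (xs⊆ys (there y∈xs)))))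
  where
  drop-x : ∀ {y} → x ≢ y → y ∈ ys₁ ++ x ∷ ys₂ → y ∈ ys₁ ++ ys₂
  drop-x x≢y y∈ with ∈.∈-++⁻ ys₁ y∈
  ... | inj₁ y∈ys₁           = ∈.∈-++⁺ˡ y∈ys₁
  ... | inj₂ (here refl)     = ⊥-elim (x≢y refl)
  ... | inj₂ (there y∈ys₂)   = ∈.∈-++⁺ʳ ys₁ y∈ys₂

Unique-interval⇒length≤ : ∀ lo m {xs} → Unique xs → All (λ a → lo < a × a ≤ lo + m) xs → length xs ≤ m
Unique-interval⇒length≤ lo m {xs} xs! xs∈ =
  subst (length xs ≤_) (trans (List.length-map _ (upTo m)) (List.length-upTo m))
        (Unique-⊆⇒length≤ xs! (λ a∈ → in-interval (All.lookup xs∈ a∈)))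
  where
  in-interval : ∀ {a} → lo < a × a ≤ lo + m → a ∈ map (λ i → suc (lo + i)) (upTo m)
  in-interval {a} (lo<a , a≤lo+m) = subst (_∈ map (λ i → suc (lo + i)) (upTo m)) a≡
    (∈.∈-map⁺ (λ i → suc (lo + i)) (∈.∈-upTo⁺ (subst (a ∸ suc lo <_) (ℕ.m+n∸m≡n lo m)
                                                  (ℕ.∸-monoˡ-< (s≤s a≤lo+m) lo<a))))
    where
    a≡ : suc (lo + (a ∸ suc lo)) ≡ a
    a≡ = ℕ.m+[n∸m]≡n lo<a

separated-ranges : ∀ n xs ys → Unique xs → Unique ys → All (InRange n) xs → All (InRange n) ys →
  length xs + length ys ≡ n → (∀ {a b} → a ∈ xs → b ∈ ys → b < a) → All (length ys <_) xs × All (_≤ length ys) ys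
separated-ranges n xs ys xs! ys! xs∈ ys∈ length≡ ys<xs = All.tabulate above , All.tabulate below
  where
  above : ∀ {a} → a ∈ xs → length ys < a
  above {zero}  a∈ with () ← proj₁ (All.lookup xs∈ a∈)
  above {suc a} a∈ with length ys ℕ.≤? a
  ... | yes |ys|≤a = s≤s |ys|≤a
  ... | no  |ys|≰a = ⊥-elim (|ys|≰a (Unique-interval⇒length≤ 0 a ys! (All.tabulate (λ b∈ →
                       proj₁ (All.lookup ys∈ b∈) , ℕ.≤-pred (ys<xs a∈ b∈)))))
  below : ∀ {b} → b ∈ ys → b ≤ length ys
  below {b} b∈ with b ℕ.≤? length ys
  ... | yes b≤|ys| = b≤|ys|
  ... | no  b≰|ys| = ⊥-elim (ℕ.<⇒≱ |xs|>n∸b |xs|≤n∸b)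
    where
    b≤n : b ≤ n
    b≤n = proj₂ (All.lookup ys∈ b∈)
    |xs|≤n∸b : length xs ≤ n ∸ b
    |xs|≤n∸b = Unique-interval⇒length≤ b (n ∸ b) xs! (All.tabulate (λ a∈ →
      ys<xs a∈ b∈ , subst (_ ≤_) (sym (ℕ.m+[n∸m]≡n b≤n)) (proj₂ (All.lookup xs∈ a∈))))
    |xs|>n∸b : n ∸ b < length xs
    |xs|>n∸b = subst (n ∸ b <_) (trans (cong (_∸ length ys) (sym length≡)) (ℕ.m+n∸n≡m (length xs) (length ys)))
                     (ℕ.∸-monoʳ-< (ℕ.≰⇒> b≰|ys|) b≤n)

avoids⇒¬contains : ∀ {σ} → avoids132 σ ≡ true → contains132 σ ≡ false
avoids⇒¬contains {σ} h = trans (sym (Bool.not-involutive _)) (cong not h)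

¬contains⇒avoids : ∀ {σ} → contains132 σ ≡ false → avoids132 σ ≡ true
¬contains⇒avoids h = cong not h

insertMax : ℕ → ℕ → List ℕ → List ℕ → List ℕ
insertMax n i α β = map (_+ (n ∸ i)) α ++ suc n ∷ β

shift-≤ : ∀ {n i a} → i ≤ n → a ≤ i → a + (n ∸ i) ≤ n
shift-≤ {n} {i} {a} i≤n a≤i = subst (a + (n ∸ i) ≤_) (ℕ.m+[n∸m]≡n i≤n) (ℕ.+-monoˡ-≤ (n ∸ i) a≤i)

insertMax-avoider : ∀ {n i α β} → i ≤ n → Is132Avoider i α → Is132Avoider (n ∸ i) β →
  Is132Avoider (suc n) (insertMax n i α β)
insertMax-avoider {n} {i} {α} {β} i≤n α-avoider β-avoider = record
  { length≡ = trans (List.length-++ α′) (trans (cong₂ (λ a b → a + suc b) (trans (List.length-map _ α) α.length≡) β.length≡)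
                                             (trans (ℕ.+-suc i c) (cong suc i+c≡n)))
  ; inRange = All.++⁺ (All.map (λ (c<a , a≤n) → ℕ.≤-trans (s≤s z≤n) c<a , ℕ.m≤n⇒m≤1+n a≤n) α′-range)
                      ((s≤s z≤n , ℕ.≤-refl) ∷ All.map (λ b≤n → proj₁ b≤n , ℕ.m≤n⇒m≤1+n (proj₂ b≤n)) β-in-n)
  ; unique  = Unique.++⁺ (Unique.map⁺ (ℕ.+-cancelʳ-≡ c _ _) α.unique)
                         (All.map (λ b≤n N≡b → ℕ.<⇒≢ (s≤s (proj₂ b≤n)) (sym N≡b)) β-in-n ∷ β.unique)
                         (λ where (a∈ , here refl) → ℕ.<⇒≢ (s≤s (proj₂ (All.lookup α′-range a∈))) refl
                                  (a∈ , there b∈)  → ℕ.<⇒≢ (All.lookup (All.lookup α′>β a∈) b∈) refl)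
  ; avoids  = ¬contains⇒avoids {insertMax n i α β} (avoids132-max α′ β
                (trans (contains132-+ c α) (avoids⇒¬contains {α} α.avoids)) (avoids⇒¬contains {β} β.avoids)
                (All.map (s≤s ∘ proj₂) α′-range) (All.map (s≤s ∘ proj₂) β-in-n) α′>β)
  }
  where
  module α = Is132Avoider α-avoider
  module β = Is132Avoider β-avoider
  c : ℕ
  c = n ∸ i
  α′ : List ℕ
  α′ = map (_+ c) α
  i+c≡n : i + c ≡ n
  i+c≡n = ℕ.m+[n∸m]≡n i≤n
  α′-range : All (λ a → c < a × a ≤ n) α′
  α′-range = All.map⁺ (All.map (λ (1≤a , a≤i) → ℕ.m<n+m c 1≤a , shift-≤ i≤n a≤i) α.inRange)
  β-in-n : All (InRange n) β
  β-in-n = All.map (λ (1≤b , b≤c) → 1≤b , ℕ.≤-trans b≤c (ℕ.m∸n≤m n i)) β.inRange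
  α′>β : All (λ a → All (_< a) β) α′
  α′>β = All.map (λ (c<a , _) → All.map (λ (_ , b≤c) → ℕ.≤-<-trans b≤c c<a) β.inRange) α′-range

max-∈ : ∀ {n σ} → Is132Avoider (suc n) σ → suc n ∈ σ
max-∈ {n} {σ} σ-avoider with suc n ∈? σ
... | yes N∈σ = N∈σ
... | no  N∉σ = ⊥-elim (ℕ.<⇒≱ (ℕ.n<1+n n) (subst (_≤ n) length≡ (Unique-interval⇒length≤ 0 n unique
                  (All.tabulate (λ {a} a∈σ → let 1≤a , a≤N = All.lookup inRange a∈σ in
                    1≤a , ℕ.≤-pred (ℕ.≤∧≢⇒< a≤N (λ a≡N → N∉σ (subst (_∈ σ) a≡N a∈σ))))))))
  where open Is132Avoider σ-avoider

module _ (c : ℕ) where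

  shift-up-down : ∀ xs → All (c <_) xs → map (_+ c) (map (_∸ c) xs) ≡ xs
  shift-up-down xs xs>c = trans (sym (List.map-∘ xs)) (List.map-id-local (All.map (ℕ.m∸n+n≡m ∘ ℕ.<⇒≤) xs>c))

  shift-down-avoider : ∀ i xs → length xs ≡ i → All (λ a → c < a × a ≤ c + i) xs → Unique xs →
    contains132 xs ≡ false → Is132Avoider i (map (_∸ c) xs)
  shift-down-avoider i xs length≡ xs∈ xs! xs-avoids = record
    { length≡ = trans (List.length-map _ xs) length≡
    ; inRange = All.map⁺ (All.map (λ {a} (c<a , a≤c+i) → ℕ.m<n⇒0<n∸m c<a ,
                                     subst (a ∸ c ≤_) (ℕ.m+n∸m≡n c i) (ℕ.∸-monoˡ-≤ c a≤c+i)) xs∈)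
    ; unique  = Unique.map⁻ (subst Unique (sym shifted) xs!)
    ; avoids  = ¬contains⇒avoids {map (_∸ c) xs}
                  (trans (sym (contains132-+ c (map (_∸ c) xs))) (trans (cong contains132 shifted) xs-avoids))
    }
    where
    shifted : map (_+ c) (map (_∸ c) xs) ≡ xs
    shifted = shift-up-down xs (All.map proj₁ xs∈)

before-max>after-max : ∀ {N} α β → Unique (α ++ N ∷ β) → All (_≤ N) β → avoids132 (α ++ N ∷ β) ≡ true →
  ∀ {a b} → a ∈ α → b ∈ β → b < a
before-max>after-max {N} α β σ! β≤N σ-avoids {a} {b} a∈ b∈ with ℕ.<-cmp a b
... | tri< a<b _ _ = ⊥-elim (true≢false (trans (sym (contains132-max α β a∈ b∈ a<b b<N))
                                               (avoids⇒¬contains {α ++ N ∷ β} σ-avoids)))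
  where
  b<N : b < N
  b<N = ℕ.≤∧≢⇒< (All.lookup β≤N b∈) (λ b≡N → All.lookup (AllPairs.head (proj₁ (proj₂ (Unique-++⁻ α σ!)))) b∈ (sym b≡N))
... | tri≈ _ a≡b _ = ⊥-elim (proj₂ (proj₂ (Unique-++⁻ α σ!)) a∈ (there b∈) a≡b)
... | tri> _ _ b<a = b<a

avoids132-++⁻ : ∀ xs ys → avoids132 (xs ++ ys) ≡ true → avoids132 xs ≡ true × avoids132 ys ≡ true
avoids132-++⁻ xs ys h = prefix , suffix
  where
  h′ : contains132 (xs ++ ys) ≡ false
  h′ = avoids⇒¬contains {xs ++ ys} h
  prefix : avoids132 xs ≡ true
  prefix with contains132 xs in xs-contains
  ... | true  = ⊥-elim (true≢false (trans (sym (contains132-++ˡ xs ys xs-contains)) h′))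
  ... | false = refl
  suffix : avoids132 ys ≡ true
  suffix with contains132 ys in ys-contains
  ... | true  = ⊥-elim (true≢false (trans (sym (contains132-++ʳ xs ys ys-contains)) h′))
  ... | false = refl

around-max : ∀ {n} α₀ β → Is132Avoider (suc n) (α₀ ++ suc n ∷ β) →
  length α₀ + length β ≡ n × All (InRange n) α₀ × All (InRange n) β
around-max {n} α₀ β σ-avoider with _ , N∷β! , α₀≢N∷β ← Unique-++⁻ α₀ (Is132Avoider.unique σ-avoider) =
  ℕ.suc-injective (trans (sym (ℕ.+-suc (length α₀) (length β))) (trans (sym (List.length-++ α₀)) length≡)) ,
  All.tabulate (λ a∈ → below-max (∈.∈-++⁺ˡ a∈) (λ a≡N → α₀≢N∷β a∈ (here refl) a≡N)) ,
  All.tabulate (λ b∈ → below-max (∈.∈-++⁺ʳ α₀ (there b∈)) (λ b≡N → All.lookup (AllPairs.head N∷β!) b∈ (sym b≡N)))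
  where
  open Is132Avoider σ-avoider
  below-max : ∀ {a} → a ∈ α₀ ++ suc n ∷ β → a ≢ suc n → InRange n a
  below-max a∈ a≢N = let 1≤a , a≤N = All.lookup inRange a∈ in 1≤a , ℕ.≤-pred (ℕ.≤∧≢⇒< a≤N a≢N)

max-split-ranges : ∀ {n} α₀ β → Is132Avoider (suc n) (α₀ ++ suc n ∷ β) →
  length α₀ + length β ≡ n × All (λ a → length β < a × a ≤ n) α₀ × All (λ b → 1 ≤ b × b ≤ length β) β
max-split-ranges {n} α₀ β σ-avoider
  with |α₀|+|β|≡n , α₀∈ , β∈ ← around-max α₀ β σ-avoider
  with α₀! , N∷β! , _ ← Unique-++⁻ α₀ (Is132Avoider.unique σ-avoider)
  with α₀>β , β≤|β| ← separated-ranges n α₀ β α₀! (AllPairs.tail N∷β!) α₀∈ β∈ |α₀|+|β|≡n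
                        (before-max>after-max α₀ β (Is132Avoider.unique σ-avoider)
                           (All.map (ℕ.m≤n⇒m≤1+n ∘ proj₂) β∈) (Is132Avoider.avoids σ-avoider))
  = |α₀|+|β|≡n , All.zipWith (λ (|β|<a , (_ , a≤n)) → |β|<a , a≤n) (α₀>β , α₀∈)
               , All.zipWith (λ ((1≤b , _) , b≤|β|) → 1≤b , b≤|β|) (β∈ , β≤|β|)

avoider-split : ∀ {n σ} → Is132Avoider (suc n) σ →
  ∃ λ i → ∃₂ λ α β → i ≤ n × Is132Avoider i α × Is132Avoider (n ∸ i) β × σ ≡ insertMax n i α β
avoider-split {n} {σ} σ-avoider
  with α₀ , β , refl ← ∈.∈-∃++ (max-∈ σ-avoider)
  with |α₀|+|β|≡n , α₀-range , β-range ← max-split-ranges α₀ β σ-avoider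
  with α₀-avoids , N∷β-avoids ← avoids132-++⁻ α₀ (suc n ∷ β) (Is132Avoider.avoids σ-avoider)
  with α₀! , N∷β! , _ ← Unique-++⁻ α₀ (Is132Avoider.unique σ-avoider)
  = length α₀ , map (_∸ c) α₀ , β , i≤n
    , shift-down-avoider c (length α₀) α₀ refl α₀-range′ α₀! (avoids⇒¬contains {α₀} α₀-avoids)
    , record { length≡ = |β|≡c
             ; inRange = All.map (λ (1≤b , b≤|β|) → 1≤b , subst (_ ≤_) |β|≡c b≤|β|) β-range
             ; unique  = AllPairs.tail N∷β!
             ; avoids  = proj₂ (avoids132-++⁻ [ suc n ] β N∷β-avoids) }
    , cong (_++ suc n ∷ β) (sym (shift-up-down c α₀ (All.map proj₁ α₀-range′)))
  where
  c : ℕ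
  c = n ∸ length α₀
  i≤n : length α₀ ≤ n
  i≤n = subst (length α₀ ≤_) |α₀|+|β|≡n (ℕ.m≤m+n (length α₀) (length β))
  |β|≡c : length β ≡ c
  |β|≡c = trans (sym (ℕ.m+n∸m≡n (length α₀) (length β))) (cong (_∸ length α₀) |α₀|+|β|≡n)
  α₀-range′ : All (λ a → c < a × a ≤ c + length α₀) α₀
  α₀-range′ = All.map (λ (|β|<a , a≤n) → subst (_< _) |β|≡c |β|<a , subst (_ ≤_) (sym (ℕ.m∸n+n≡m i≤n)) a≤n) α₀-range

module _ {A B C : Set} (f : A → B → C) where

  private
    map-unique : ∀ x ys → Unique ys → (∀ {y y′} → y ∈ ys → y′ ∈ ys → f x y ≡ f x y′ → y ≡ y′) →
      Unique (map (f x) ys)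
    map-unique x []       _            _   = []
    map-unique x (y ∷ ys) (y∉ys ∷ ys!) inj =
      All.map⁺ (All.tabulate (λ y′∈ fxy≡fxy′ → All.lookup y∉ys y′∈ (inj (here refl) (there y′∈) fxy≡fxy′)))
      ∷ map-unique x ys ys! (λ y∈ y′∈ → inj (there y∈) (there y′∈))

  cartesianProductWith-unique : ∀ xs ys → Unique xs → Unique ys →
    (∀ {x x′ y y′} → x ∈ xs → x′ ∈ xs → y ∈ ys → y′ ∈ ys → f x y ≡ f x′ y′ → x ≡ x′ × y ≡ y′) →
    Unique (cartesianProductWith f xs ys)
  cartesianProductWith-unique []       ys _            _   _   = []
  cartesianProductWith-unique (x ∷ xs) ys (x∉xs ∷ xs!) ys! inj =
    Unique.++⁺ (map-unique x ys ys! (λ y∈ y′∈ → proj₂ ∘ inj (here refl) (here refl) y∈ y′∈))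
               (cartesianProductWith-unique xs ys xs! ys! (λ x∈ x′∈ → inj (there x∈) (there x′∈)))
               disjoint
    where
    disjoint : ∀ {z} → ¬ (z ∈ map (f x) ys × z ∈ cartesianProductWith f xs ys)
    disjoint (z∈ , z∈′)
      with y , y∈ , refl ← ∈.∈-map⁻ (f x) z∈
      with x′ , y′ , x′∈ , y′∈ , fxy≡fx′y′ ← ∈.∈-cartesianProductWith⁻ f xs ys z∈′
      = All.lookup x∉xs x′∈ (proj₁ (inj (here refl) (there x′∈) y∈ y′∈ fxy≡fx′y′))

++-∷-cancel : ∀ {A : Set} {N : A} {xs ys zs ws : List A} → N ∉ xs → N ∉ ys → xs ++ N ∷ zs ≡ ys ++ N ∷ ws → xs ≡ ys × zs ≡ ws
++-∷-cancel {xs = []}     {[]}     _    _    refl = refl , refl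
++-∷-cancel {xs = []}     {y ∷ ys} _    N∉ys eq   = ⊥-elim (N∉ys (here (List.∷-injectiveˡ eq)))
++-∷-cancel {xs = x ∷ xs} {[]}     N∉xs _    eq   = ⊥-elim (N∉xs (here (sym (List.∷-injectiveˡ eq))))
++-∷-cancel {xs = x ∷ xs} {y ∷ ys} N∉xs N∉ys eq
  with refl , eq′ ← List.∷-injective eq
  with xs≡ys , zs≡ws ← ++-∷-cancel (N∉xs ∘ there) (N∉ys ∘ there) eq′ = cong (x ∷_) xs≡ys , zs≡ws

max∉shifted : ∀ {n i α} → i ≤ n → Is132Avoider i α → suc n ∉ map (_+ (n ∸ i)) α
max∉shifted {n} {i} {α} i≤n α-avoider N∈ with a , a∈ , N≡a+c ← ∈.∈-map⁻ (_+ (n ∸ i)) N∈ =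
  ℕ.<⇒≢ (s≤s (shift-≤ i≤n (proj₂ (All.lookup (Is132Avoider.inRange α-avoider) a∈)))) (sym N≡a+c)

insertMax-injective : ∀ {n i j α α′ β β′} → i ≤ n → j ≤ n → Is132Avoider i α → Is132Avoider j α′ →
  insertMax n i α β ≡ insertMax n j α′ β′ → i ≡ j × α ≡ α′ × β ≡ β′
insertMax-injective {n} {i} {j} {α} {α′} i≤n j≤n α-avoider α′-avoider eq
  with prefix≡ , β≡β′ ← ++-∷-cancel (max∉shifted i≤n α-avoider) (max∉shifted j≤n α′-avoider) eq
  with refl ← trans (sym (Is132Avoider.length≡ α-avoider)) (trans (sym (List.length-map _ α))
                (trans (cong length prefix≡) (trans (List.length-map _ α′) (Is132Avoider.length≡ α′-avoider))))
  = refl , List.map-injective (ℕ.+-cancelʳ-≡ (n ∸ i) _ _) prefix≡ , β≡β′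

block : ℕ → ℕ → List (List ℕ)
block n i = cartesianProductWith (insertMax n i) (S132 i) (S132 (n ∸ i))

blocksUpTo : ℕ → ℕ → List (List ℕ)
blocksUpTo n zero    = block n 0
blocksUpTo n (suc m) = blocksUpTo n m ++ block n (suc m)

∈-block⁻ : ∀ n i {σ} → σ ∈ block n i → ∃₂ λ α β → α ∈ S132 i × β ∈ S132 (n ∸ i) × σ ≡ insertMax n i α β
∈-block⁻ n i = ∈.∈-cartesianProductWith⁻ (insertMax n i) (S132 i) (S132 (n ∸ i))

∈-blocksUpTo⁻ : ∀ n m {σ} → σ ∈ blocksUpTo n m → ∃ λ i → i ≤ m × σ ∈ block n i
∈-blocksUpTo⁻ n zero    σ∈ = 0 , z≤n , σ∈
∈-blocksUpTo⁻ n (suc m) σ∈ with ∈.∈-++⁻ (blocksUpTo n m) σ∈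
... | inj₁ σ∈′ = let i , i≤m , σ∈″ = ∈-blocksUpTo⁻ n m σ∈′ in i , ℕ.m≤n⇒m≤1+n i≤m , σ∈″
... | inj₂ σ∈′ = suc m , ℕ.≤-refl , σ∈′

∈-blocksUpTo⁺ : ∀ n m {i σ} → i ≤ m → σ ∈ block n i → σ ∈ blocksUpTo n m
∈-blocksUpTo⁺ n zero    z≤n σ∈ = σ∈
∈-blocksUpTo⁺ n (suc m) {i} i≤1+m σ∈ with i ℕ.≟ suc m
... | yes refl  = ∈.∈-++⁺ʳ (blocksUpTo n m) σ∈
... | no  i≢1+m = ∈.∈-++⁺ˡ (∈-blocksUpTo⁺ n m (ℕ.≤-pred (ℕ.≤∧≢⇒< i≤1+m i≢1+m)) σ∈)

block-unique : ∀ n i → i ≤ n → Unique (block n i)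
block-unique n i i≤n = cartesianProductWith-unique (insertMax n i) (S132 i) (S132 (n ∸ i))
  (S132-unique i) (S132-unique (n ∸ i))
  (λ α∈ α′∈ _ _ eq → proj₂ (insertMax-injective i≤n i≤n (∈-S132⁻ α∈) (∈-S132⁻ α′∈) eq))

block-index : ∀ n i j {σ} → i ≤ n → j ≤ n → σ ∈ block n i → σ ∈ block n j → i ≡ j
block-index n i j i≤n j≤n σ∈ σ∈′
  with α , β , α∈ , _ , refl ← ∈-block⁻ n i σ∈
  with α′ , β′ , α′∈ , _ , eq ← ∈-block⁻ n j σ∈′
  = proj₁ (insertMax-injective i≤n j≤n (∈-S132⁻ α∈) (∈-S132⁻ α′∈) eq)

blocksUpTo-unique : ∀ n m → m ≤ n → Unique (blocksUpTo n m)
blocksUpTo-unique n zero    _     = block-unique n 0 z≤n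
blocksUpTo-unique n (suc m) 1+m≤n = Unique.++⁺ (blocksUpTo-unique n m (ℕ.<⇒≤ 1+m≤n)) (block-unique n (suc m) 1+m≤n)
  λ (σ∈ , σ∈′) → let i , i≤m , σ∈″ = ∈-blocksUpTo⁻ n m σ∈ in
    ℕ.<⇒≢ (s≤s i≤m) (block-index n i (suc m) (ℕ.≤-trans i≤m (ℕ.<⇒≤ 1+m≤n)) 1+m≤n σ∈″ σ∈′)

S132-suc↭blocks : ∀ n → S132 (suc n) ↭ blocksUpTo n n
S132-suc↭blocks n = ∼bag⇒↭ (unique∧set⇒bag (S132-unique (suc n)) (blocksUpTo-unique n n ℕ.≤-refl) (mk⇔ to from))
  where
  to : ∀ {σ} → σ ∈ S132 (suc n) → σ ∈ blocksUpTo n n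
  to σ∈ with i , α , β , i≤n , α-avoider , β-avoider , refl ← avoider-split {n} (∈-S132⁻ σ∈) =
    ∈-blocksUpTo⁺ n n i≤n (∈.∈-cartesianProductWith⁺ (insertMax n i) (∈-S132⁺ α-avoider) (∈-S132⁺ β-avoider))
  from : ∀ {σ} → σ ∈ blocksUpTo n n → σ ∈ S132 (suc n)
  from σ∈
    with i , i≤n , σ∈′ ← ∈-blocksUpTo⁻ n n σ∈
    with α , β , α∈ , β∈ , refl ← ∈-block⁻ n i σ∈′
    = ∈-S132⁺ (insertMax-avoider i≤n (∈-S132⁻ α∈) (∈-S132⁻ β∈))

count-blocksUpTo : ∀ q n m → count q (blocksUpTo n m)
  ≡ ℕSum.sum m (λ i → countPairs (λ α β → q (insertMax n i α β)) (S132 i) (S132 (n ∸ i)))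
count-blocksUpTo q n zero    = count-cartesianProductWith q (insertMax n 0) (S132 0) (S132 n)
count-blocksUpTo q n (suc m) = trans (count-++ q (blocksUpTo n m) (block n (suc m)))
  (cong₂ _+_ (count-blocksUpTo q n m)
             (count-cartesianProductWith q (insertMax n (suc m)) (S132 (suc m)) (S132 (n ∸ suc m))))

count-S132-suc : ∀ q n → count q (S132 (suc n))
  ≡ ℕSum.sum n (λ i → countPairs (λ α β → q (insertMax n i α β)) (S132 i) (S132 (n ∸ i)))
count-S132-suc q n = trans (count-↭ q (S132-suc↭blocks n)) (count-blocksUpTo q n n)

-- The box statistic and the gains

≡ᵇ-sym : ∀ a b → (a ≡ᵇ b) ≡ (b ≡ᵇ a)
≡ᵇ-sym a b = true⇔⇒≡ (≡⇒≡ᵇ ∘ sym ∘ ≡ᵇ⇒≡ a b) (≡⇒≡ᵇ ∘ sym ∘ ≡ᵇ⇒≡ b a)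

≡ᵇ-refl : ∀ a → (a ≡ᵇ a) ≡ true
≡ᵇ-refl a = ≡⇒≡ᵇ {a} refl

≡ᵇ-+ : ∀ a b c → ((a + c) ≡ᵇ (b + c)) ≡ (a ≡ᵇ b)
≡ᵇ-+ a b c = true⇔⇒≡ (≡⇒≡ᵇ ∘ ℕ.+-cancelʳ-≡ c a b ∘ ≡ᵇ⇒≡ (a + c) (b + c)) (≡⇒≡ᵇ ∘ cong (_+ c) ∘ ≡ᵇ⇒≡ a b)

adj-+ : ∀ a b c → adj (a + c) (b + c) ≡ adj a b
adj-+ a b c = cong₂ _∨_ (≡ᵇ-+ a (suc b) c) (≡ᵇ-+ b (suc a) c)

≢-suc-suc : ∀ {n b} → b ≤ n → b ≢ suc (suc n)
≢-suc-suc {n} b≤n b≡2+n = ℕ.<⇒≱ (ℕ.m<n⇒m<1+n (ℕ.n<1+n n)) (subst (_≤ n) b≡2+n b≤n)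

adj-max-left : ∀ {n b} → b ≤ n → adj (suc n) b ≡ (b ≡ᵇ n)
adj-max-left {n} {b} b≤n rewrite ≢⇒≢ᵇ (≢-suc-suc b≤n) = trans (Bool.∨-identityʳ (n ≡ᵇ b)) (≡ᵇ-sym n b)

adj-max-right : ∀ {n b} → b ≤ n → adj b (suc n) ≡ (b ≡ᵇ n)
adj-max-right {n} {b} b≤n rewrite ≢⇒≢ᵇ (≢-suc-suc b≤n) = ≡ᵇ-sym n b

¬adj-max-left : ∀ {n b} → b < n → adj (suc n) b ≡ false
¬adj-max-left b<n = trans (adj-max-left (ℕ.<⇒≤ b<n)) (≢⇒≢ᵇ (ℕ.<⇒≢ b<n))

¬adj-max-right : ∀ {n b} → b < n → adj b (suc n) ≡ false
¬adj-max-right b<n = trans (adj-max-right (ℕ.<⇒≤ b<n)) (≢⇒≢ᵇ (ℕ.<⇒≢ b<n))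

-- The increase of box when n + 1 is put in front of σ ⊆ {1,…,n}, resp. appended to it.
frontGain : ℕ → List ℕ → ℕ
frontGain n []      = 0
frontGain n (b ∷ σ) = if b ≡ᵇ n then (if adjM (headM σ) b then 1 else 2) else 0

backGainFrom : ℕ → Maybe ℕ → List ℕ → ℕ
backGainFrom n p []          = 0
backGainFrom n p (a ∷ [])    = if a ≡ᵇ n then (if adjM p a then 1 else 2) else 0
backGainFrom n p (a ∷ b ∷ σ) = backGainFrom n (just a) (b ∷ σ)

backGain : ℕ → List ℕ → ℕ
backGain n = backGainFrom n nothing

boxFrom-after-max : ∀ n β → All (_< n) β → boxAux (just (suc n)) β ≡ box β
boxFrom-after-max n []      _         = refl
boxFrom-after-max n (b ∷ β) (b<n ∷ _) rewrite ¬adj-max-left b<n = refl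

adjM-head-max : ∀ n β → All (_< n) β → adjM (headM β) (suc n) ≡ false
adjM-head-max n []      _         = refl
adjM-head-max n (b ∷ β) (b<n ∷ _) = ¬adj-max-right b<n

box-max∷ : ∀ n β → All (_≤ n) β → box (suc n ∷ β) ≡ box β + frontGain n β
box-max∷ n []      _         = refl
box-max∷ n (b ∷ β) (b≤n ∷ _) rewrite adj-max-right b≤n | adj-max-left b≤n with b ≡ᵇ n | adjM (headM β) b
... | true  | true  = cong suc (ℕ.+-comm 1 (boxAux (just b) β))
... | true  | false = ℕ.+-comm 2 (boxAux (just b) β)
... | false | _     = sym (ℕ.+-identityʳ _)

boxFrom-++-max : ∀ n p a xs β → All (_≤ n) (a ∷ xs) → All (_< n) β →
  boxAux p ((a ∷ xs) ++ suc n ∷ β) ≡ boxAux p (a ∷ xs) + backGainFrom n p (a ∷ xs) + box β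
boxFrom-++-max n p a [] β (a≤n ∷ []) β<n
  rewrite adj-max-left a≤n | adj-max-right a≤n | adjM-head-max n β β<n | boxFrom-after-max n β β<n
        | Bool.∨-identityʳ (adjM p a)
  with a ≡ᵇ n | adjM p a
... | true  | true  = refl
... | true  | false = refl
... | false | true  = refl
... | false | false = refl
boxFrom-++-max n p a (b ∷ xs) β (a≤n ∷ b∷xs≤n) β<n = begin
  d + boxAux (just a) ((b ∷ xs) ++ suc n ∷ β)
    ≡⟨ cong (λ m → d + m) (boxFrom-++-max n (just a) b xs β b∷xs≤n β<n) ⟩
  d + (boxAux (just a) (b ∷ xs) + backGainFrom n (just a) (b ∷ xs) + box β)
    ≡⟨ sym (ℕ.+-assoc d _ (box β)) ⟩
  d + (boxAux (just a) (b ∷ xs) + backGainFrom n (just a) (b ∷ xs)) + box β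
    ≡⟨ cong (_+ box β) (sym (ℕ.+-assoc d _ _)) ⟩
  d + boxAux (just a) (b ∷ xs) + backGainFrom n (just a) (b ∷ xs) + box β ∎
  where
  open ≡.≡-Reasoning
  d : ℕ
  d = if adjM p a ∨ adj b a then 1 else 0

module _ (c : ℕ) where

  adjM-+ : ∀ p a → adjM (Maybe.map (_+ c) p) (a + c) ≡ adjM p a
  adjM-+ nothing  a = refl
  adjM-+ (just b) a = adj-+ b a c

  headM-+ : ∀ xs → headM (map (_+ c) xs) ≡ Maybe.map (_+ c) (headM xs)
  headM-+ []      = refl
  headM-+ (_ ∷ _) = refl

  boxFrom-+ : ∀ p xs → boxAux (Maybe.map (_+ c) p) (map (_+ c) xs) ≡ boxAux p xs
  boxFrom-+ p []      = refl
  boxFrom-+ p (a ∷ xs) rewrite adjM-+ p a | headM-+ xs | adjM-+ (headM xs) a =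
    cong (λ m → (if adjM p a ∨ adjM (headM xs) a then 1 else 0) + m) (boxFrom-+ (just a) xs)

  backGainFrom-+ : ∀ i p xs → backGainFrom (i + c) (Maybe.map (_+ c) p) (map (_+ c) xs) ≡ backGainFrom i p xs
  backGainFrom-+ i p []           = refl
  backGainFrom-+ i p (a ∷ [])     rewrite ≡ᵇ-+ a i c | adjM-+ p a = refl
  backGainFrom-+ i p (a ∷ b ∷ xs) = backGainFrom-+ i (just a) (b ∷ xs)

frontGain-max∷ : ∀ n β → All (_≤ n) β → frontGain (suc n) (suc n ∷ β) ≡ (if frontGain n β ≡ᵇ 0 then 2 else 1)
frontGain-max∷ n []      _         rewrite ≡ᵇ-refl n = refl
frontGain-max∷ n (b ∷ β) (b≤n ∷ _) rewrite ≡ᵇ-refl n | adj-max-right b≤n with b ≡ᵇ n | adjM (headM β) b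
... | true  | true  = refl
... | true  | false = refl
... | false | _     = refl

frontGain-below : ∀ n a σ → a ≤ n → frontGain (suc n) (a ∷ σ) ≡ 0
frontGain-below n a σ a≤n rewrite ≢⇒≢ᵇ (ℕ.<⇒≢ (s≤s a≤n)) = refl

backGainFrom-below : ∀ n p xs → All (_≤ n) xs → backGainFrom (suc n) p xs ≡ 0
backGainFrom-below n p []           _           = refl
backGainFrom-below n p (a ∷ [])     (a≤n ∷ _)   rewrite ≢⇒≢ᵇ (ℕ.<⇒≢ (s≤s a≤n)) = refl
backGainFrom-below n p (a ∷ b ∷ xs) (_ ∷ b∷xs≤n) = backGainFrom-below n (just a) (b ∷ xs) b∷xs≤n

backGainFrom-++-max : ∀ n p a xs → All (_≤ n) (a ∷ xs) →
  backGainFrom (suc n) p ((a ∷ xs) ++ [ suc n ]) ≡ (if backGainFrom n p (a ∷ xs) ≡ᵇ 0 then 2 else 1)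
backGainFrom-++-max n p a []       (a≤n ∷ _) rewrite ≡ᵇ-refl n | adj-max-right a≤n with a ≡ᵇ n | adjM p a
... | true  | true  = refl
... | true  | false = refl
... | false | _     = refl
backGainFrom-++-max n p a (b ∷ xs) (_ ∷ b∷xs≤n) = backGainFrom-++-max n (just a) b xs b∷xs≤n

-- The back gain only looks at the last two entries.
backGainFrom-++ : ∀ N p xs y ys → (∀ q → backGainFrom N q (y ∷ ys) ≡ 0) → backGainFrom N p (xs ++ y ∷ ys) ≡ 0
backGainFrom-++ N p []           y ys vanishes = vanishes p
backGainFrom-++ N p (x ∷ [])     y ys vanishes = vanishes (just x)
backGainFrom-++ N p (x ∷ x′ ∷ xs) y ys vanishes = backGainFrom-++ N (just x) (x′ ∷ xs) y ys vanishes

headIs-frontGain : ∀ {n} {E : List ℕ → Bool} → E [] ≡ false → (∀ a σ → E (a ∷ σ) ≡ (a ≡ᵇ n)) →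
  ∀ σ → E σ ≡ not (frontGain n σ ≡ᵇ 0)
headIs-frontGain E-[] E-∷ []      = E-[]
headIs-frontGain {n} E-[] E-∷ (b ∷ σ) rewrite E-∷ b σ with b ≡ᵇ n | adjM (headM σ) b
... | true  | true  = refl
... | true  | false = refl
... | false | _     = refl

lastIs-backGainFrom : ∀ {n} {E : List ℕ → Bool} → E [] ≡ false → (∀ a → E [ a ] ≡ (a ≡ᵇ n)) →
  (∀ a b σ → E (a ∷ b ∷ σ) ≡ E (b ∷ σ)) → ∀ p σ → E σ ≡ not (backGainFrom n p σ ≡ᵇ 0)
lastIs-backGainFrom E-[] E-[_] E-∷∷ p []          = E-[]
lastIs-backGainFrom {n} E-[] E-[_] E-∷∷ p (a ∷ [])    rewrite E-[ a ] with a ≡ᵇ n | adjM p a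
... | true  | true  = refl
... | true  | false = refl
... | false | _     = refl
lastIs-backGainFrom {n} {E} E-[] E-[_] E-∷∷ p (a ∷ b ∷ σ) =
  trans (E-∷∷ a b σ) (lastIs-backGainFrom {n} {E} E-[] E-[_] E-∷∷ (just a) (b ∷ σ))

frontGain≤2 : ∀ n σ → frontGain n σ ≤ 2
frontGain≤2 n []      = z≤n
frontGain≤2 n (b ∷ σ) with b ≡ᵇ n | adjM (headM σ) b
... | true  | true  = s≤s z≤n
... | true  | false = s≤s (s≤s z≤n)
... | false | _     = z≤n

backGainFrom≤2 : ∀ n p σ → backGainFrom n p σ ≤ 2
backGainFrom≤2 n p []          = z≤n
backGainFrom≤2 n p (a ∷ [])    with a ≡ᵇ n | adjM p a
... | true  | true  = s≤s z≤n
... | true  | false = s≤s (s≤s z≤n)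
... | false | _     = z≤n
backGainFrom≤2 n p (a ∷ b ∷ σ) = backGainFrom≤2 n (just a) (b ∷ σ)

S132-≤ : ∀ {n σ} → σ ∈ S132 n → All (_≤ n) σ
S132-≤ {n} σ∈ = All.map proj₂ (Is132Avoider.inRange (∈-S132⁻ {n} σ∈))

frontGain-insertMax : ∀ n i α β → suc i ≤ n → α ∈ S132 (suc i) → frontGain (suc n) (insertMax n (suc i) α β) ≡ 0
frontGain-insertMax n i []      β _     α∈ with () ← Is132Avoider.length≡ (∈-S132⁻ {suc i} α∈)
frontGain-insertMax n i (a ∷ α) β 1+i≤n α∈ =
  frontGain-below n (a + (n ∸ suc i)) (map (_+ (n ∸ suc i)) α ++ suc n ∷ β) (shift-≤ 1+i≤n (All.head (S132-≤ α∈)))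

box-insertMax : ∀ n i α β → suc i ≤ n → α ∈ S132 (suc i) → β ∈ S132 (n ∸ suc i) →
  box (insertMax n (suc i) α β) ≡ box α + backGain (suc i) α + box β
box-insertMax n i []      β _     α∈ _  with () ← Is132Avoider.length≡ (∈-S132⁻ {suc i} α∈)
box-insertMax n i (a ∷ α) β 1+i≤n α∈ β∈ = begin
  box (map (_+ c) (a ∷ α) ++ suc n ∷ β)
    ≡⟨ boxFrom-++-max n nothing (a + c) (map (_+ c) α) β (All.map⁺ (All.map (shift-≤ 1+i≤n) (S132-≤ α∈))) β<n ⟩
  box (map (_+ c) (a ∷ α)) + backGain n (map (_+ c) (a ∷ α)) + box β
    ≡⟨ cong (λ m → box (map (_+ c) (a ∷ α)) + backGain m (map (_+ c) (a ∷ α)) + box β) (ℕ.m+[n∸m]≡n 1+i≤n) ⟨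
  box (map (_+ c) (a ∷ α)) + backGain (suc i + c) (map (_+ c) (a ∷ α)) + box β
    ≡⟨ cong₂ (λ x y → x + y + box β) (boxFrom-+ c nothing (a ∷ α)) (backGainFrom-+ c (suc i) nothing (a ∷ α)) ⟩
  box (a ∷ α) + backGain (suc i) (a ∷ α) + box β ∎
  where
  open ≡.≡-Reasoning
  c : ℕ
  c = n ∸ suc i
  β<n : All (_< n) β
  β<n = All.map (λ b≤c → ℕ.≤-<-trans b≤c (ℕ.∸-monoʳ-< (s≤s z≤n) 1+i≤n)) (S132-≤ β∈)

backGain-insertMax : ∀ n i α β → i < n → β ∈ S132 (n ∸ i) → backGain (suc n) (insertMax n i α β) ≡ 0
backGain-insertMax n i α []      i<n β∈ with () ← trans (Is132Avoider.length≡ (∈-S132⁻ {n ∸ i} β∈)) (ℕ.+-∸-assoc 1 i<n)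
backGain-insertMax n i α (b ∷ β) i<n β∈ = backGainFrom-++ (suc n) nothing (map (_+ (n ∸ i)) α) (suc n) (b ∷ β)
  (λ _ → backGainFrom-below n (just (suc n)) (b ∷ β) (All.map (λ b≤ → ℕ.≤-trans b≤ (ℕ.m∸n≤m n i)) (S132-≤ β∈)))

box-max∷ʳ : ∀ n α → All (_≤ n) α → box (α ++ [ suc n ]) ≡ box α + backGain n α
box-max∷ʳ n []      _   = refl
box-max∷ʳ n (a ∷ α) α≤n = trans (boxFrom-++-max n nothing a α [] α≤n []) (ℕ.+-identityʳ _)

backGain-max∷ʳ : ∀ n α → All (_≤ n) α → backGain (suc n) (α ++ [ suc n ]) ≡ (if backGain n α ≡ᵇ 0 then 2 else 1)
backGain-max∷ʳ n []      _   rewrite ≡ᵇ-refl n = refl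
backGain-max∷ʳ n (a ∷ α) α≤n = backGainFrom-++-max n nothing a α α≤n

-- Recurrences for the counts

boxCount : ℕ → ℕ → ℕ
boxCount n k = count (λ σ → box σ ≡ᵇ k) (S132 n)

Gain : Set
Gain = ℕ → List ℕ → ℕ

classCount : Gain → ℕ → ℕ → ℕ → ℕ
classCount g c n k = count (λ σ → (g n σ ≡ᵇ c) ∧ (box σ ≡ᵇ k)) (S132 n)

gainCount : Gain → ℕ → ℕ → ℕ
gainCount g n k = count (λ σ → (box σ + g n σ) ≡ᵇ k) (S132 n)

module _ (g : Gain) (n : ℕ) (g≤2 : ∀ σ → g n σ ≤ 2) where

  boxCount-classes : ∀ k → boxCount n k ≡ classCount g 0 n k + classCount g 1 n k + classCount g 2 n k
  boxCount-classes k = count-by-class (g n) (λ _ σ → box σ ≡ᵇ k) (S132 n) g≤2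

  gainCount-classes : ∀ k →
    gainCount g n k ≡ classCount g 0 n k + shift 1 (classCount g 1 n) k + shift 2 (classCount g 2 n) k
  gainCount-classes k = trans (count-by-class (g n) (λ c σ → (box σ + c) ≡ᵇ k) (S132 n) g≤2)
    (cong₂ _+_ (cong₂ _+_ (count-+-shift (λ σ → g n σ ≡ᵇ 0) box 0 k (S132 n))
                          (count-+-shift (λ σ → g n σ ≡ᵇ 1) box 1 k (S132 n)))
               (count-+-shift (λ σ → g n σ ≡ᵇ 2) box 2 k (S132 n)))

  gained-classes : ∀ k → count (λ σ → not (g n σ ≡ᵇ 0) ∧ (box σ ≡ᵇ k)) (S132 n) ≡ classCount g 1 n k + classCount g 2 n k
  gained-classes k = trans (count-by-class (g n) (λ c σ → not (c ≡ᵇ 0) ∧ (box σ ≡ᵇ k)) (S132 n) g≤2)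
    (cong (λ m → m + classCount g 1 n k + classCount g 2 n k)
          (count-zero _ (S132 n) (λ σ _ → Bool.∧-zeroʳ (g n σ ≡ᵇ 0))))

  gained-gainCount : ∀ k → count (λ σ → not (g n σ ≡ᵇ 0) ∧ ((box σ + g n σ) ≡ᵇ k)) (S132 n)
    ≡ shift 1 (classCount g 1 n) k + shift 2 (classCount g 2 n) k
  gained-gainCount k = trans (count-by-class (g n) (λ c σ → not (c ≡ᵇ 0) ∧ ((box σ + c) ≡ᵇ k)) (S132 n) g≤2)
    (cong₂ _+_ (cong₂ _+_ (count-zero _ (S132 n) (λ σ _ → Bool.∧-zeroʳ (g n σ ≡ᵇ 0)))
                          (count-+-shift (λ σ → g n σ ≡ᵇ 1) box 1 k (S132 n)))
               (count-+-shift (λ σ → g n σ ≡ᵇ 2) box 2 k (S132 n)))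

-- q may only accept permutations starting (resp. ending) with n + 1: all others have gain 0.
count-S132-suc-front : ∀ n q → (∀ σ → frontGain (suc n) σ ≡ 0 → q σ ≡ false) →
  count q (S132 (suc n)) ≡ count (λ β → q (suc n ∷ β)) (S132 n)
count-S132-suc-front n q q⇒front = begin
  count q (S132 (suc n))             ≡⟨ count-S132-suc q n ⟩
  ℕSum.sum n term                    ≡⟨ ℕSum.sum-single n 0 term z≤n vanishes ⟩
  count (λ β → q (suc n ∷ β)) (S132 n) + 0 ≡⟨ ℕ.+-identityʳ _ ⟩
  count (λ β → q (suc n ∷ β)) (S132 n) ∎
  where
  open ≡.≡-Reasoning
  term : ℕ → ℕ
  term i = countPairs (λ α β → q (insertMax n i α β)) (S132 i) (S132 (n ∸ i))
  vanishes : ∀ i → i ≤ n → i ≢ 0 → term i ≡ 0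
  vanishes zero    _     0≢0 = ⊥-elim (0≢0 refl)
  vanishes (suc i) 1+i≤n _   = countPairs-zero _ (S132 (suc i)) (S132 (n ∸ suc i)) (λ α β α∈ _ →
    q⇒front (insertMax n (suc i) α β) (frontGain-insertMax n i α β 1+i≤n α∈))

count-S132-suc-back : ∀ n q → (∀ σ → backGain (suc n) σ ≡ 0 → q σ ≡ false) →
  count q (S132 (suc n)) ≡ count (λ α → q (α ++ [ suc n ])) (S132 n)
count-S132-suc-back n q q⇒back = begin
  count q (S132 (suc n))                              ≡⟨ count-S132-suc q n ⟩
  ℕSum.sum n term                                     ≡⟨ ℕSum.sum-single n n term ℕ.≤-refl vanishes ⟩
  term n
    ≡⟨ cong (λ m → countPairs (λ α β → q (map (_+ m) α ++ suc n ∷ β)) (S132 n) (S132 m)) (ℕ.n∸n≡0 n) ⟩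
  countPairs (λ α β → q (map (_+ 0) α ++ suc n ∷ β)) (S132 n) [ [] ]
    ≡⟨ countPairs-singletonʳ _ (S132 n) [] ⟩
  count (λ α → q (map (_+ 0) α ++ [ suc n ])) (S132 n)
    ≡⟨ count-cong (S132 n) (λ α _ → cong (λ α′ → q (α′ ++ [ suc n ]))
                                         (List.map-id-local (All.tabulate (λ _ → ℕ.+-identityʳ _)))) ⟩
  count (λ α → q (α ++ [ suc n ])) (S132 n)           ∎
  where
  open ≡.≡-Reasoning
  term : ℕ → ℕ
  term i = countPairs (λ α β → q (insertMax n i α β)) (S132 i) (S132 (n ∸ i))
  vanishes : ∀ i → i ≤ n → i ≢ n → term i ≡ 0
  vanishes i i≤n i≢n = countPairs-zero _ (S132 i) (S132 (n ∸ i)) (λ α β _ β∈ →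
    q⇒back (insertMax n i α β) (backGain-insertMax n i α β (ℕ.≤∧≢⇒< i≤n i≢n) β∈))

record ClassRecurrence (X : ℕ → ℕ → ℕ → ℕ) : Set where
  field
    class₁-suc : ∀ n k → X 1 (suc n) k ≡ shift 1 (X 1 n) k + shift 2 (X 2 n) k
    class₂-suc : ∀ n k → X 2 (suc n) k ≡ X 0 n k
    classes    : ∀ n k → boxCount n k ≡ X 0 n k + X 1 n k + X 2 n k

-- Class 0 is what the other two classes leave of boxCount.
ClassRecurrence-unique : ∀ {X Y} → ClassRecurrence X → ClassRecurrence Y → (∀ c k → X c 0 k ≡ Y c 0 k) →
  ∀ n k → X 0 n k ≡ Y 0 n k × X 1 n k ≡ Y 1 n k × X 2 n k ≡ Y 2 n k
ClassRecurrence-unique {X} {Y} X-rec Y-rec base n k = agree₀ n k , agree₁₂ n k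
  where
  module X = ClassRecurrence X-rec
  module Y = ClassRecurrence Y-rec
  agree₀ : ∀ n k → X 0 n k ≡ Y 0 n k
  agree₁₂ : ∀ n k → X 1 n k ≡ Y 1 n k × X 2 n k ≡ Y 2 n k
  agree₀ n k = ℕ.+-cancelʳ-≡ (X 1 n k + X 2 n k) _ _ (begin
    X 0 n k + (X 1 n k + X 2 n k)  ≡⟨ ℕ.+-assoc (X 0 n k) _ _ ⟨
    X 0 n k + X 1 n k + X 2 n k    ≡⟨ trans (sym (X.classes n k)) (Y.classes n k) ⟩
    Y 0 n k + Y 1 n k + Y 2 n k    ≡⟨ ℕ.+-assoc (Y 0 n k) _ _ ⟩
    Y 0 n k + (Y 1 n k + Y 2 n k)  ≡⟨ cong (λ m → Y 0 n k + m) (cong₂ _+_ (proj₁ (agree₁₂ n k)) (proj₂ (agree₁₂ n k))) ⟨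
    Y 0 n k + (X 1 n k + X 2 n k)  ∎)
    where open ≡.≡-Reasoning
  agree₁₂ zero    k = base 1 k , base 2 k
  agree₁₂ (suc n) k =
    trans (X.class₁-suc n k) (trans (cong₂ _+_ (shift-cong 1 (proj₁ ∘ agree₁₂ n) k) (shift-cong 2 (proj₂ ∘ agree₁₂ n) k))
                                    (sym (Y.class₁-suc n k)))
    , trans (X.class₂-suc n k) (trans (agree₀ n k) (sym (Y.class₂-suc n k)))

-- Front and back gains obey the same rules when a new maximum is attached at their end of σ,
-- and these rules alone give the class recurrences.
module MaxInsertion
  (g : Gain) (g≤2 : ∀ n σ → g n σ ≤ 2) (attach : ℕ → List ℕ → List ℕ)
  (count-attach : ∀ n q → (∀ σ → g (suc n) σ ≡ 0 → q σ ≡ false) →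
                  count q (S132 (suc n)) ≡ count (λ σ → q (attach n σ)) (S132 n))
  (gain-attach : ∀ n σ → σ ∈ S132 n → g (suc n) (attach n σ) ≡ (if g n σ ≡ᵇ 0 then 2 else 1))
  (box-attach : ∀ n σ → σ ∈ S132 n → box (attach n σ) ≡ box σ + g n σ)
  where

  private
    attached : ∀ {n σ} → σ ∈ S132 n → ∀ (P : ℕ → ℕ → Bool) →
      P (g (suc n) (attach n σ)) (box (attach n σ)) ≡ P (if g n σ ≡ᵇ 0 then 2 else 1) (box σ + g n σ)
    attached {n} {σ} σ∈ P = cong₂ P (gain-attach n σ σ∈) (box-attach n σ σ∈)

    gain≡1 : ∀ G X → ((if G ≡ᵇ 0 then 2 else 1) ≡ᵇ 1) ∧ X ≡ not (G ≡ᵇ 0) ∧ X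
    gain≡1 G X with G ≡ᵇ 0
    ... | true  = refl
    ... | false = refl

    gain≡2 : ∀ G b k → ((if G ≡ᵇ 0 then 2 else 1) ≡ᵇ 2) ∧ ((b + G) ≡ᵇ k) ≡ (G ≡ᵇ 0) ∧ (b ≡ᵇ k)
    gain≡2 zero    b k = cong (_≡ᵇ k) (ℕ.+-identityʳ b)
    gain≡2 (suc G) b k = refl

    gain≢0 : ∀ G X → not ((if G ≡ᵇ 0 then 2 else 1) ≡ᵇ 0) ∧ X ≡ X
    gain≢0 G X with G ≡ᵇ 0
    ... | true  = refl
    ... | false = refl

  class₁-suc : ∀ n k → classCount g 1 (suc n) k ≡ shift 1 (classCount g 1 n) k + shift 2 (classCount g 2 n) k
  class₁-suc n k = begin
    classCount g 1 (suc n) k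
      ≡⟨ count-attach n _ (λ σ g≡0 → cong (λ m → (m ≡ᵇ 1) ∧ (box σ ≡ᵇ k)) g≡0) ⟩
    count (λ σ → (g (suc n) (attach n σ) ≡ᵇ 1) ∧ (box (attach n σ) ≡ᵇ k)) (S132 n)
      ≡⟨ count-cong (S132 n) (λ σ σ∈ → trans (attached σ∈ (λ m b → (m ≡ᵇ 1) ∧ (b ≡ᵇ k))) (gain≡1 (g n σ) _)) ⟩
    count (λ σ → not (g n σ ≡ᵇ 0) ∧ ((box σ + g n σ) ≡ᵇ k)) (S132 n)
      ≡⟨ gained-gainCount g n (g≤2 n) k ⟩
    shift 1 (classCount g 1 n) k + shift 2 (classCount g 2 n) k ∎
    where open ≡.≡-Reasoning

  class₂-suc : ∀ n k → classCount g 2 (suc n) k ≡ classCount g 0 n k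
  class₂-suc n k = trans (count-attach n _ (λ σ g≡0 → cong (λ m → (m ≡ᵇ 2) ∧ (box σ ≡ᵇ k)) g≡0))
    (count-cong (S132 n) (λ σ σ∈ → trans (attached σ∈ (λ m b → (m ≡ᵇ 2) ∧ (b ≡ᵇ k))) (gain≡2 (g n σ) (box σ) k)))

  gained-suc : ∀ n k → count (λ σ → not (g (suc n) σ ≡ᵇ 0) ∧ (box σ ≡ᵇ k)) (S132 (suc n)) ≡ gainCount g n k
  gained-suc n k = trans (count-attach n _ (λ σ g≡0 → cong (λ m → not (m ≡ᵇ 0) ∧ (box σ ≡ᵇ k)) g≡0))
    (count-cong (S132 n) (λ σ σ∈ → trans (attached σ∈ (λ m b → not (m ≡ᵇ 0) ∧ (b ≡ᵇ k))) (gain≢0 (g n σ) _)))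

  classRecurrence : ClassRecurrence (classCount g)
  classRecurrence = record
    { class₁-suc = class₁-suc
    ; class₂-suc = class₂-suc
    ; classes    = λ n → boxCount-classes g n (g≤2 n) }

module Front = MaxInsertion frontGain frontGain≤2 (λ n β → suc n ∷ β) count-S132-suc-front
  (λ n β β∈ → frontGain-max∷ n β (S132-≤ β∈)) (λ n β β∈ → box-max∷ n β (S132-≤ β∈))

module Back = MaxInsertion backGain (λ n → backGainFrom≤2 n nothing) (λ n α → α ++ [ suc n ]) count-S132-suc-back
  (λ n α α∈ → backGain-max∷ʳ n α (S132-≤ α∈)) (λ n α α∈ → box-max∷ʳ n α (S132-≤ α∈))

front≡back : ∀ n k → classCount frontGain 0 n k ≡ classCount backGain 0 n k
                   × classCount frontGain 1 n k ≡ classCount backGain 1 n k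
                   × classCount frontGain 2 n k ≡ classCount backGain 2 n k
front≡back = ClassRecurrence-unique Front.classRecurrence Back.classRecurrence
  (λ c k → count-cong (S132 0) (λ σ σ∈ → trans (cong (λ σ → (frontGain 0 σ ≡ᵇ c) ∧ (box σ ≡ᵇ k)) (S132-zero σ∈))
                                                (cong (λ σ → (backGain 0 σ ≡ᵇ c) ∧ (box σ ≡ᵇ k)) (sym (S132-zero σ∈)))))
  where
  S132-zero : ∀ {σ} → σ ∈ S132 0 → σ ≡ []
  S132-zero {[]}    _  = refl
  S132-zero {_ ∷ _} σ∈ with () ← Is132Avoider.length≡ (∈-S132⁻ {0} σ∈)

gainCount-front≡back : ∀ n k → gainCount frontGain n k ≡ gainCount backGain n k
gainCount-front≡back n k = begin
  gainCount frontGain n k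
    ≡⟨ gainCount-classes frontGain n (frontGain≤2 n) k ⟩
  classCount frontGain 0 n k + shift 1 (classCount frontGain 1 n) k + shift 2 (classCount frontGain 2 n) k
    ≡⟨ cong₂ _+_ (cong₂ _+_ (proj₁ (front≡back n k)) (shift-cong 1 (λ j → proj₁ (proj₂ (front≡back n j))) k))
                 (shift-cong 2 (λ j → proj₂ (proj₂ (front≡back n j))) k) ⟩
  classCount backGain 0 n k + shift 1 (classCount backGain 1 n) k + shift 2 (classCount backGain 2 n) k
    ≡⟨ gainCount-classes backGain n (backGainFrom≤2 n nothing) k ⟨
  gainCount backGain n k ∎
  where open ≡.≡-Reasoning

-- The added boxCount n k is the i = 0 term of the convolution, as S₀(132) = {[]}.
boxCount-suc : ∀ n k → boxCount (suc n) k + boxCount n k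
  ≡ gainCount frontGain n k + ℕSum.sum n (λ i → ℕSum.sum k (λ j → gainCount backGain i j * boxCount (n ∸ i) (k ∸ j)))
boxCount-suc n k = begin
  boxCount (suc n) k + boxCount n k   ≡⟨ cong₂ _+_ (count-S132-suc (λ σ → box σ ≡ᵇ k) n) (sym U₀) ⟩
  ℕSum.sum n T + U 0                  ≡⟨ ℕSum.sum-swap-head n T U T≡U ⟩
  T 0 + ℕSum.sum n U                  ≡⟨ cong (_+ ℕSum.sum n U) T₀ ⟩
  gainCount frontGain n k + ℕSum.sum n U ∎
  where
  open ≡.≡-Reasoning
  T U : ℕ → ℕ
  T i = countPairs (λ α β → box (insertMax n i α β) ≡ᵇ k) (S132 i) (S132 (n ∸ i))
  U i = ℕSum.sum k (λ j → gainCount backGain i j * boxCount (n ∸ i) (k ∸ j))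
  T₀ : T 0 ≡ gainCount frontGain n k
  T₀ = trans (ℕ.+-identityʳ _) (count-cong (S132 n) (λ β β∈ → cong (_≡ᵇ k) (box-max∷ n β (S132-≤ β∈))))
  U₀ : U 0 ≡ boxCount n k
  U₀ = begin
    U 0
      ≡⟨ ℕSum.sum-cong k (λ j _ → cong (_* boxCount n (k ∸ j))
           (trans (count-∷ (λ σ → (box σ + backGain 0 σ) ≡ᵇ j) [] []) (ℕ.+-identityʳ _))) ⟩
    ℕSum.sum k (λ j → fromBool (0 ≡ᵇ j) * boxCount n (k ∸ j)) ≡⟨ ℕSum.sum-single k 0 _ z≤n (λ where
                                                                  zero    _ 0≢0 → ⊥-elim (0≢0 refl)
                                                                  (suc j) _ _   → refl) ⟩
    1 * boxCount n k                                        ≡⟨ ℕ.*-identityˡ _ ⟩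
    boxCount n k                                            ∎
  T≡U : ∀ i → i < n → T (suc i) ≡ U (suc i)
  T≡U i i<n = trans
    (countPairs-cong (S132 (suc i)) (S132 (n ∸ suc i)) (λ α β α∈ β∈ → cong (_≡ᵇ k) (box-insertMax n i α β i<n α∈ β∈)))
    (countPairs-+ (λ α → box α + backGain (suc i) α) box k (S132 (suc i)) (S132 (n ∸ suc i)))

-- The generating functions

-- Bgf and Egf test the first and last entry through a local helper of Defs, which enters only
-- through its defining equations (the predicate E below).
count-S-test : ∀ n k {E : List ℕ → Bool} (G : List ℕ → ℕ) → (∀ σ → E σ ≡ not (G σ ≡ᵇ 0)) →
  count (λ σ → (avoids132 σ ∧ E σ) ∧ (box σ ≡ᵇ k)) (S n) ≡ count (λ σ → not (G σ ≡ᵇ 0) ∧ (box σ ≡ᵇ k)) (S132 n)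
count-S-test n k G E≡ = trans
  (count-cong (S n) (λ σ _ → trans (Bool.∧-assoc (avoids132 σ) _ _)
                                   (cong (λ b → avoids132 σ ∧ (b ∧ (box σ ≡ᵇ k))) (E≡ σ))))
  (sym (count-filter avoids132 (λ σ → not (G σ ≡ᵇ 0) ∧ (box σ ≡ᵇ k)) (S n)))

Agf-count : ∀ n k → Agf n k ≡ + boxCount n k
Agf-count n k = cong +_ (sym (count-filter avoids132 (λ σ → box σ ≡ᵇ k) (S n)))

Bgf-count : ∀ n k → Bgf n k ≡ + count (λ σ → not (frontGain n σ ≡ᵇ 0) ∧ (box σ ≡ᵇ k)) (S132 n)
Bgf-count n k = cong +_ (count-S-test n k (frontGain n) (headIs-frontGain refl (λ _ _ → refl)))

Egf-count : ∀ n k → Egf n k ≡ + count (λ σ → not (backGain n σ ≡ᵇ 0) ∧ (box σ ≡ᵇ k)) (S132 n)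
Egf-count n k = cong +_ (count-S-test n k (backGain n) (lastIs-backGainFrom refl (λ _ → refl) (λ _ _ _ → refl) nothing))

A⁺ B₁ B₂ : Series
A⁺ n k = + gainCount frontGain n k
B₁ n k = + classCount frontGain 1 n k
B₂ n k = + classCount frontGain 2 n k

B-split : Bgf ≈ B₁ ⊕ B₂
B-split n k = trans (Bgf-count n k) (trans (cong +_ (gained-classes frontGain n (frontGain≤2 n) k))
  (ℤ.pos-+ (classCount frontGain 1 n k) (classCount frontGain 2 n k)))

B-rec : Bgf ≈ tS ⊛ A⁺
B-rec zero    k = trans (Bgf-count 0 k) (sym (tS⊛-zero A⁺ k))
B-rec (suc n) k = trans (Bgf-count (suc n) k) (trans (cong +_ (Front.gained-suc n k)) (sym (tS⊛-suc A⁺ n k)))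

B₂-rec : B₂ ≈ tS ⊛ (Agf ⊖ Bgf)
B₂-rec zero    k = sym (tS⊛-zero (Agf ⊖ Bgf) k)
B₂-rec (suc n) k = begin
  + classCount frontGain 2 (suc n) k                 ≡⟨ cong +_ (Front.class₂-suc n k) ⟩
  + c 0                                              ≡⟨ cong +_ (ℕ.m+n∸n≡m (c 0) (c 1 + c 2)) ⟨
  + (c 0 + (c 1 + c 2) ∸ (c 1 + c 2))                ≡⟨ ℤ.⊖-≥ (ℕ.m≤n+m (c 1 + c 2) (c 0)) ⟨
  (c 0 + (c 1 + c 2)) ℤ.⊖ (c 1 + c 2)                ≡⟨ ℤ.m-n≡m⊖n (c 0 + (c 1 + c 2)) (c 1 + c 2) ⟨
  + (c 0 + (c 1 + c 2)) ℤ.- + (c 1 + c 2)            ≡⟨ cong (λ m → + m ℤ.- + (c 1 + c 2)) (ℕ.+-assoc (c 0) (c 1) (c 2)) ⟨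
  + (c 0 + c 1 + c 2) ℤ.- + (c 1 + c 2)
    ≡⟨ cong₂ ℤ._-_ (trans (Agf-count n k) (cong +_ (boxCount-classes frontGain n (frontGain≤2 n) k)))
                   (trans (Bgf-count n k) (cong +_ (gained-classes frontGain n (frontGain≤2 n) k))) ⟨
  Agf n k ℤ.- Bgf n k                                ≡⟨ tS⊛-suc (Agf ⊖ Bgf) n k ⟨
  (tS ⊛ (Agf ⊖ Bgf)) (suc n) k                       ∎
  where
  open ≡.≡-Reasoning
  c : ℕ → ℕ
  c i = classCount frontGain i n k

B₁-rec : B₁ ≈ tS ⊛ (xS ⊛ (B₁ ⊕ xS ⊛ B₂))
B₁-rec zero    k = sym (tS⊛-zero (xS ⊛ (B₁ ⊕ xS ⊛ B₂)) k)
B₁-rec (suc n) k = begin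
  + classCount frontGain 1 (suc n) k                            ≡⟨ cong +_ (Front.class₁-suc n k) ⟩
  + (shift 1 (classCount frontGain 1 n) k + shift 2 (classCount frontGain 2 n) k)
    ≡⟨ cong +_ (shift-+ k) ⟩
  + shift 1 (λ j → classCount frontGain 1 n j + shift 1 (classCount frontGain 2 n) j) k
    ≡⟨ xS⊛-+ (λ n j → classCount frontGain 1 n j + shift 1 (classCount frontGain 2 n) j) n k ⟨
  (xS ⊛ (λ n j → + (classCount frontGain 1 n j + shift 1 (classCount frontGain 2 n) j))) n k
    ≡⟨ *-cong {xS} {xS} (λ _ _ → refl) inner n k ⟩
  (xS ⊛ (B₁ ⊕ xS ⊛ B₂)) n k                                     ≡⟨ tS⊛-suc (xS ⊛ (B₁ ⊕ xS ⊛ B₂)) n k ⟨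
  (tS ⊛ (xS ⊛ (B₁ ⊕ xS ⊛ B₂))) (suc n) k                        ∎
  where
  open ≡.≡-Reasoning
  inner : (λ n j → + (classCount frontGain 1 n j + shift 1 (classCount frontGain 2 n) j)) ≈ B₁ ⊕ xS ⊛ B₂
  inner n j = trans (ℤ.pos-+ (classCount frontGain 1 n j) _)
                    (cong (λ z → B₁ n j ℤ.+ z) (sym (xS⊛-+ (classCount frontGain 2) n j)))
  shift-+ : ∀ k → shift 1 (classCount frontGain 1 n) k + shift 2 (classCount frontGain 2 n) k
                ≡ shift 1 (λ j → classCount frontGain 1 n j + shift 1 (classCount frontGain 2 n) j) k
  shift-+ zero    = refl
  shift-+ (suc k) = refl

A-rec : Agf ⊕ tS ⊛ Agf ≈ 1S ⊕ tS ⊛ A⁺ ⊕ tS ⊛ (A⁺ ⊛ Agf)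
A-rec zero    k = trans (cong (λ z → Agf 0 k ℤ.+ z) (tS⊛-zero Agf k))
  (trans (t⁰ k) (sym (cong₂ (λ a b → 1S 0 k ℤ.+ a ℤ.+ b) (tS⊛-zero A⁺ k) (tS⊛-zero (A⁺ ⊛ Agf) k))))
  where
  t⁰ : ∀ k → Agf 0 k ℤ.+ + 0 ≡ 1S 0 k ℤ.+ + 0 ℤ.+ + 0
  t⁰ zero    = refl
  t⁰ (suc k) = refl
A-rec (suc n) k = begin
  Agf (suc n) k ℤ.+ (tS ⊛ Agf) (suc n) k
    ≡⟨ cong₂ ℤ._+_ (Agf-count (suc n) k) (trans (tS⊛-suc Agf n k) (Agf-count n k)) ⟩
  + boxCount (suc n) k ℤ.+ + boxCount n k
    ≡⟨ ℤ.pos-+ (boxCount (suc n) k) (boxCount n k) ⟨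
  + (boxCount (suc n) k + boxCount n k)
    ≡⟨ cong +_ (boxCount-suc n k) ⟩
  + (gainCount frontGain n k + ℕSum.sum n (λ i → ℕSum.sum k (λ j → gainCount backGain i j * boxCount (n ∸ i) (k ∸ j))))
    ≡⟨ ℤ.pos-+ (gainCount frontGain n k) _ ⟩
  A⁺ n k ℤ.+ + ℕSum.sum n (λ i → ℕSum.sum k (λ j → gainCount backGain i j * boxCount (n ∸ i) (k ∸ j)))
    ≡⟨ cong (λ z → A⁺ n k ℤ.+ z) (sym (trans (⊛-A n k) (⊛-+ gainCount′ boxCount n k))) ⟩
  A⁺ n k ℤ.+ (A⁺ ⊛ Agf) n k
    ≡⟨ cong₂ ℤ._+_ (trans (ℤ.+-identityˡ _) (tS⊛-suc A⁺ n k)) (tS⊛-suc (A⁺ ⊛ Agf) n k) ⟨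
  1S (suc n) k ℤ.+ (tS ⊛ A⁺) (suc n) k ℤ.+ (tS ⊛ (A⁺ ⊛ Agf)) (suc n) k ∎
  where
  open ≡.≡-Reasoning
  gainCount′ : ℕ → ℕ → ℕ
  gainCount′ = gainCount backGain
  ⊛-A : A⁺ ⊛ Agf ≈ (λ n k → + gainCount′ n k) ⊛ (λ n k → + boxCount n k)
  ⊛-A = *-cong (λ n k → cong +_ (gainCount-front≡back n k)) Agf-count

E≈B : Egf ≈ Bgf
E≈B n k = begin
  Egf n k
    ≡⟨ Egf-count n k ⟩
  + count (λ σ → not (backGain n σ ≡ᵇ 0) ∧ (box σ ≡ᵇ k)) (S132 n)
    ≡⟨ cong +_ (gained-classes backGain n (backGainFrom≤2 n nothing) k) ⟩
  + (classCount backGain 1 n k + classCount backGain 2 n k)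
    ≡⟨ cong +_ (cong₂ _+_ (proj₁ (proj₂ (front≡back n k))) (proj₂ (proj₂ (front≡back n k)))) ⟨
  + (classCount frontGain 1 n k + classCount frontGain 2 n k)
    ≡⟨ cong +_ (gained-classes frontGain n (frontGain≤2 n) k) ⟨
  + count (λ σ → not (frontGain n σ ≡ᵇ 0) ∧ (box σ ≡ᵇ k)) (S132 n)
    ≡⟨ Bgf-count n k ⟨
  Bgf n k ∎
  where open ≡.≡-Reasoning

theorem1 : Σ Series (λ sqrtF → (sqrtF ⊛ sqrtF ≈ Fp)
    × (sqrtF 0 0 ≡ + 1) × ((k : ℕ) → sqrtF 0 (suc k) ≡ + 0)
    × (const (+ 2) ⊛ Qp ⊛ Agf ≈ Pp ⊖ sqrtF))
    × (Rp ⊛ Bgf ≈ Qp ⊛ Agf) × (Egf ≈ Bgf)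
theorem1 = (root , root²≈F , root-t⁰ 0 , root-t⁰ ∘ suc , 2QA≈P-root) , R⊛B≈Q⊛A , E≈B
  where open FunctionalEquations Agf Bgf B₁ B₂ A⁺ A-rec B-rec B₁-rec B₂-rec B-split
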